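{- The determining number of the augmented hypercube $AQ_n$ is $\det(AQ_n)=1$ if $n=1$; $3$ if $n=2$; $4$ if $n=3$; $3$ if $n\in\{4,5\}$; and $2$ if $n\ge 6$.
   Context: The augmented hypercube $AQ_n$ has vertex set $\mathbb{Z}_2^n$; two vertices $a=a_1\dots a_n$ and $b=b_1\dots b_n$ are adjacent iff either they differ in exactly one position, or for some $0\le \ell\le n-2$ they agree in the first $\ell$ positions and differ in all of the remaining $n-\ell$ positions. A determining set of a graph is a vertex set such that the only automorphism fixing each of its vertices is the identity; $\det$ is the minimum size of a determining set. -}

module Defs where

open import Data.Nat using (ℕ; _+_; _≤_; _<_)
open import Data.Bool using (Bool)
open import Data.Fin using (Fin; toℕ)
open import Data.Vec using (Vec; lookup)
open import Data.List using (List; length)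
open import Data.List.Membership.Propositional using (_∈_)
open import Data.List.Relation.Unary.Unique.Propositional using (Unique)
open import Data.Product using (Σ; ∃; _×_; _,_)
open import Data.Sum using (_⊎_)
open import Relation.Binary.PropositionalEquality using (_≡_; _≢_)
open import Relation.Nullary using (¬_)

-- Vertices of AQ_n : binary strings of length n (position i ↔ index i, 0-based).
Vertex : ℕ → Set
Vertex n = Vec Bool n

DifferInOne : ∀ {n} → Vertex n → Vertex n → Set
DifferInOne {n} a b =
  Σ (Fin n) λ i → (lookup a i ≢ lookup b i) × (∀ j → j ≢ i → lookup a j ≡ lookup b j)

ComplementEdge : ∀ {n} → Vertex n → Vertex n → Set
ComplementEdge {n} a b =
  Σ ℕ λ ℓ → (ℓ + 2 ≤ n)
    × (∀ (i : Fin n) → toℕ i < ℓ → lookup a i ≡ lookup b i)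
    × (∀ (i : Fin n) → ℓ ≤ toℕ i → lookup a i ≢ lookup b i)

Adj : ∀ {n} → Vertex n → Vertex n → Set
Adj a b = DifferInOne a b ⊎ ComplementEdge a b

record Automorphism (n : ℕ) : Set where
  field
    to      : Vertex n → Vertex n
    from    : Vertex n → Vertex n
    to-from : ∀ v → to (from v) ≡ v
    from-to : ∀ v → from (to v) ≡ v
    adj⇒    : ∀ a b → Adj a b → Adj (to a) (to b)
    adj⇐    : ∀ a b → Adj (to a) (to b) → Adj a b

IsDetermining : ∀ n → List (Vertex n) → Set
IsDetermining n S =
  ∀ (φ : Automorphism n) → (∀ v → v ∈ S → Automorphism.to φ v ≡ v)
    → ∀ v → Automorphism.to φ v ≡ v

DetNumber : ℕ → ℕ → Set
DetNumber n k =
  (Σ (List (Vertex n)) λ S → Unique S × length S ≡ k × IsDetermining n S)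
  × (∀ (S : List (Vertex n)) → Unique S → IsDetermining n S → k ≤ length S)

module Submission where

-- The difference map δ x = (x₀, x₀ ⊕ x₁, …, xₙ₋₂ ⊕ xₙ₋₁) is an isomorphism from AQₙ onto the Cayley graph of
-- ℤ₂ⁿ with connection set D = {eᵢ} ∪ {eᵢ ⊕ eᵢ₊₁}, so determining sets can be studied there.
--
-- For n ≤ 5 both bounds are verified by computation: repeatedly adding every vertex that is the only one with
-- its adjacency pattern towards the vertices fixed so far shows that the given sets are determining, and for
-- every smaller set an explicit automorphism fixing it (after a translation) shows it is not.
--
-- For n ≥ 6 the automorphisms fixing 0 are the eight maps generated by the reversal and the end swaps
-- e₀ ↔ e₀ ⊕ e₁ and eₙ₋₁ ↔ eₙ₋₂ ⊕ eₙ₋₁. Among the generators exactly the interior units e₁, …, eₙ₋₂ have three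
-- common neighbours with 0, so an automorphism fixing 0 maps e₁ to e₁ or eₙ₋₂, and walking along the path
-- e₁, e₂, … it fixes all interior units up to the reversal; the two end units can only be swapped with their
-- neighbouring pairs. Once all of D is fixed, every vertex is, being the unique fourth corner of a square
-- through three fixed vertices. None of the seven non-identity maps fixes e₀ ⊕ e₂ ⊕ eₙ₋₁, so
-- {0, e₀ ⊕ e₂ ⊕ eₙ₋₁} is determining, whereas every single vertex is fixed by a conjugate of the front swap.

open import Defs
open import Algebra.Bundles using (CommutativeRing)
open import Data.Bool using (Bool; true; false; not; _xor_; _∧_; _∨_; T)
import Data.Bool as Bool
open import Data.Bool.ListAction using (all; any)
open import Data.Bool.Properties
  using (T?; T-∧; T-∨; xor-comm; xor-assoc; xor-same; xor-identityˡ; xor-identityʳ; xor-∧-commutativeRing)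
open import Algebra.Properties.CommutativeSemigroup (CommutativeRing.+-commutativeSemigroup xor-∧-commutativeRing)
  using (interchange)
open import Data.Empty using (⊥; ⊥-elim)
open import Data.Fin using () renaming (zero to fzero; suc to fsuc)
import Data.Fin.Properties as Fin
open import Data.List using (List; []; _∷_; length; map; _++_; filterᵇ; upTo)
open import Data.List.Properties using (length-map)
open import Data.List.Membership.Propositional using (_∈_; find)
open import Data.List.Membership.Propositional.Properties using (∈-map⁺; ∈-++⁺ˡ; ∈-++⁺ʳ; ∈-++⁻; ∈-filter⁻; ∈-upTo⁺)
open import Data.List.Relation.Unary.All using (All; []; _∷_)
import Data.List.Relation.Unary.All as All
import Data.List.Relation.Unary.All.Properties as All
open import Data.List.Relation.Unary.AllPairs using ([]; _∷_)
import Data.List.Relation.Unary.AllPairs as AllPairs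
open import Data.List.Relation.Unary.Any using (here; there)
import Data.List.Relation.Unary.Any as Any
import Data.List.Relation.Unary.Any.Properties as Any
open import Data.List.Relation.Unary.Linked using (Linked; []; [-]; _∷_)
import Data.List.Relation.Unary.Linked as Linked
import Data.List.Relation.Unary.Linked.Properties as Linked
open import Data.List.Relation.Unary.Unique.Propositional using (Unique)
open import Data.List.Relation.Unary.Unique.Propositional.Properties using () renaming (map⁺ to Unique-map⁺)
open import Data.Nat using (ℕ; zero; suc; _+_; _∸_; _≤_; _<_; z≤n; s≤s; _≟_; _<?_; _≤?_)
open import Data.Nat.Properties
  using (≤-refl; ≤-trans; <⇒≤; <-irrefl; <-trans; <⇒≢; n≤1+n; ≤-pred; suc-injective; ≤-antisym; ≮⇒≥; ≰⇒>;
         m∸n≤m; n∸n≡0; m∸[m∸n]≡n; m+n∸n≡m; ∸-monoʳ-<)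
open import Data.Product using (Σ; _×_; _,_; proj₁; proj₂)
open import Data.Sum using (_⊎_; inj₁; inj₂)
import Data.Sum as Sum
open import Data.Vec using ([]; _∷_; lookup; zipWith; replicate; reverse; _∷ʳ_)
open import Data.Vec.Properties
  using (zipWith-comm; zipWith-assoc; zipWith-identityˡ; zipWith-identityʳ; ∷-injectiveʳ; reverse-∷; reverse-involutive;
         tabulate∘lookup; tabulate-cong; ≡-dec)
open import Function using (_∘_; Equivalence; mk⇔)
open import Relation.Binary.PropositionalEquality
open import Relation.Nullary using (¬_; Dec; yes; no; does; ⌊_⌋; map′; ¬?)
open import Relation.Nullary.Decidable using (toWitness; fromWitness; toWitnessFalse; isYes≗does; does-⇔)

open ≡-Reasoning

infixl 6 _⊕_

_⊕_ : ∀ {n} → Vertex n → Vertex n → Vertex n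
_⊕_ = zipWith _xor_

𝟎 : ∀ {n} → Vertex n
𝟎 = replicate _ false

⊕-comm : ∀ {n} (x y : Vertex n) → x ⊕ y ≡ y ⊕ x
⊕-comm = zipWith-comm xor-comm

⊕-assoc : ∀ {n} (x y z : Vertex n) → (x ⊕ y) ⊕ z ≡ x ⊕ (y ⊕ z)
⊕-assoc = zipWith-assoc xor-assoc

⊕-identityˡ : ∀ {n} (x : Vertex n) → 𝟎 ⊕ x ≡ x
⊕-identityˡ = zipWith-identityˡ xor-identityˡ

⊕-identityʳ : ∀ {n} (x : Vertex n) → x ⊕ 𝟎 ≡ x
⊕-identityʳ = zipWith-identityʳ xor-identityʳ

⊕-self : ∀ {n} (x : Vertex n) → x ⊕ x ≡ 𝟎
⊕-self [] = refl
⊕-self (a ∷ x) = cong₂ _∷_ (xor-same a) (⊕-self x)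

⊕-cancelˡ : ∀ {n} (x y : Vertex n) → x ⊕ (x ⊕ y) ≡ y
⊕-cancelˡ x y = trans (sym (⊕-assoc x x y)) (trans (cong (_⊕ y) (⊕-self x)) (⊕-identityˡ y))

⊕-cancelʳ : ∀ {n} (x y : Vertex n) → (y ⊕ x) ⊕ x ≡ y
⊕-cancelʳ x y = trans (⊕-assoc y x x) (trans (cong (y ⊕_) (⊕-self x)) (⊕-identityʳ y))

⊕-cancelˡʳ : ∀ {n} (x y : Vertex n) → (x ⊕ y) ⊕ x ≡ y
⊕-cancelˡʳ x y = trans (cong (_⊕ x) (⊕-comm x y)) (⊕-cancelʳ x y)

⊕-swap : ∀ {n} (x y z : Vertex n) → x ⊕ (y ⊕ z) ≡ y ⊕ (x ⊕ z)
⊕-swap x y z = trans (sym (⊕-assoc x y z)) (trans (cong (_⊕ z) (⊕-comm x y)) (⊕-assoc y x z))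

⊕-translation : ∀ {n} (t x y : Vertex n) → (t ⊕ x) ⊕ (t ⊕ y) ≡ x ⊕ y
⊕-translation t x y = trans (⊕-assoc t x (t ⊕ y)) (trans (cong (t ⊕_) (⊕-swap x t y)) (⊕-cancelˡ t (x ⊕ y)))

⊕-telescope : ∀ {n} (x y z : Vertex n) → (x ⊕ y) ⊕ (y ⊕ z) ≡ x ⊕ z
⊕-telescope x y z = trans (⊕-assoc x y (y ⊕ z)) (cong (x ⊕_) (⊕-cancelˡ y z))

⊕-solveˡ : ∀ {n} {x y z : Vertex n} → x ⊕ y ≡ z → y ≡ x ⊕ z
⊕-solveˡ {x = x} {y} eq = trans (sym (⊕-cancelˡ x y)) (cong (x ⊕_) eq)

⊕-solveʳ : ∀ {n} {x y z : Vertex n} → x ⊕ y ≡ z → x ≡ z ⊕ y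
⊕-solveʳ {x = x} {y} eq = trans (sym (⊕-cancelʳ y x)) (cong (_⊕ y) eq)

⊕≡𝟎⇒≡ : ∀ {n} {x y : Vertex n} → x ⊕ y ≡ 𝟎 → x ≡ y
⊕≡𝟎⇒≡ {x = x} {y} eq = trans (⊕-solveˡ (trans (⊕-comm y x) eq)) (⊕-identityʳ y)

true≢false : true ≢ false
true≢false ()

bit : ∀ {n} → Vertex n → ℕ → Bool
bit [] k = false
bit (a ∷ x) zero = a
bit (a ∷ x) (suc k) = bit x k

bit-⊕ : ∀ {n} (x y : Vertex n) k → bit (x ⊕ y) k ≡ bit x k xor bit y k
bit-⊕ [] [] k = refl
bit-⊕ (a ∷ x) (b ∷ y) zero = refl
bit-⊕ (a ∷ x) (b ∷ y) (suc k) = bit-⊕ x y k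

bit-𝟎 : ∀ {n} k → bit (𝟎 {n}) k ≡ false
bit-𝟎 {zero} k = refl
bit-𝟎 {suc n} zero = refl
bit-𝟎 {suc n} (suc k) = bit-𝟎 {n} k

bit-out : ∀ {n} (x : Vertex n) k → n ≤ k → bit x k ≡ false
bit-out [] k _ = refl
bit-out (a ∷ x) (suc k) (s≤s le) = bit-out x k le

bit-ext : ∀ {n} {x y : Vertex n} → (∀ k → bit x k ≡ bit y k) → x ≡ y
bit-ext {x = []} {[]} h = refl
bit-ext {x = a ∷ x} {b ∷ y} h = cong₂ _∷_ (h 0) (bit-ext (λ k → h (suc k)))

-- Out of range, e i is the zero vector.
e : ∀ {n} → ℕ → Vertex n
e {zero} _ = []
e {suc n} zero = true ∷ 𝟎
e {suc n} (suc i) = false ∷ e i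

pair : ∀ {n} → ℕ → Vertex n
pair i = e i ⊕ e (suc i)

e-out : ∀ {n} i → n ≤ i → e {n} i ≡ 𝟎
e-out {zero} i _ = refl
e-out {suc n} (suc i) (s≤s le) = cong (false ∷_) (e-out i le)

bit-e-same : ∀ {n} i → i < n → bit (e {n} i) i ≡ true
bit-e-same {suc n} zero _ = refl
bit-e-same {suc n} (suc i) (s≤s lt) = bit-e-same i lt

bit-e-other : ∀ {n} i k → i ≢ k → bit (e {n} i) k ≡ false
bit-e-other {zero} i k ne = refl
bit-e-other {suc n} zero zero ne = ⊥-elim (ne refl)
bit-e-other {suc n} zero (suc k) ne = bit-𝟎 {n} k
bit-e-other {suc n} (suc i) zero ne = refl
bit-e-other {suc n} (suc i) (suc k) ne = bit-e-other {n} i k (λ eq → ne (cong suc eq))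

e≢𝟎 : ∀ {n} i → i < n → e {n} i ≢ 𝟎
e≢𝟎 {n} i lt eq with trans (sym (bit-e-same i lt)) (trans (cong (λ x → bit x i) eq) (bit-𝟎 {n} i))
... | ()

e-injective : ∀ {n} i j → i < n → e {n} i ≡ e j → i ≡ j
e-injective {suc n} zero zero _ _ = refl
e-injective {suc n} (suc i) (suc j) (s≤s lt) eq = cong suc (e-injective i j lt (∷-injectiveʳ eq))
e-injective {suc n} zero (suc j) _ ()
e-injective {suc n} (suc i) zero _ ()

-- The Cayley graph and its automorphisms

data IsZero : ∀ {n} → Vertex n → Set where
  z[] : IsZero []
  z∷  : ∀ {n} {x : Vertex n} → IsZero x → IsZero (false ∷ x)

IsZero⇒≡𝟎 : ∀ {n} {x : Vertex n} → IsZero x → x ≡ 𝟎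
IsZero⇒≡𝟎 z[] = refl
IsZero⇒≡𝟎 (z∷ z) = cong (false ∷_) (IsZero⇒≡𝟎 z)

IsZero-𝟎 : ∀ {n} → IsZero (𝟎 {n})
IsZero-𝟎 {zero} = z[]
IsZero-𝟎 {suc n} = z∷ IsZero-𝟎

≡𝟎⇒IsZero : ∀ {n} {x : Vertex n} → x ≡ 𝟎 → IsZero x
≡𝟎⇒IsZero refl = IsZero-𝟎

bit-IsZero : ∀ {n} {z : Vertex n} → IsZero z → ∀ k → bit z k ≡ false
bit-IsZero z[] k = refl
bit-IsZero (z∷ z) zero = refl
bit-IsZero (z∷ z) (suc k) = bit-IsZero z k

¬bit-IsZero : ∀ {n} {z : Vertex n} → IsZero z → ∀ {k} → bit z k ≢ true
¬bit-IsZero z {k} b = true≢false (trans (sym b) (bit-IsZero z k))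

bit-IsZero-⊕ : ∀ {n} {z : Vertex n} → IsZero z → ∀ g k → bit (z ⊕ g) k ≡ bit g k
bit-IsZero-⊕ {z = z} zz g k = trans (bit-⊕ z g k) (cong (_xor bit g k) (bit-IsZero zz k))

IsZero-⊕ : ∀ {n} {z : Vertex n} → IsZero z → ∀ g → z ⊕ g ≡ g
IsZero-⊕ z g = trans (cong (_⊕ g) (IsZero⇒≡𝟎 z)) (⊕-identityˡ g)

-- Gen x: x is one of the eᵢ or eᵢ ⊕ eᵢ₊₁, i.e. x ∈ D.
data Gen : ∀ {n} → Vertex n → Set where
  unit₀ : ∀ {n} {x : Vertex n} → IsZero x → Gen (true ∷ x)
  pair₀ : ∀ {n} {x : Vertex n} → IsZero x → Gen (true ∷ true ∷ x)
  shift : ∀ {n} {x : Vertex n} → Gen x → Gen (false ∷ x)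

CAdj : ∀ {n} → Vertex n → Vertex n → Set
CAdj x y = Gen (x ⊕ y)

record CAut (n : ℕ) : Set where
  field
    to      : Vertex n → Vertex n
    from    : Vertex n → Vertex n
    to-from : ∀ v → to (from v) ≡ v
    from-to : ∀ v → from (to v) ≡ v
    adj⇒    : ∀ a b → CAdj a b → CAdj (to a) (to b)
    adj⇐    : ∀ a b → CAdj (to a) (to b) → CAdj a b

  to-injective : ∀ {a b} → to a ≡ to b → a ≡ b
  to-injective {a} {b} eq = trans (sym (from-to a)) (trans (cong from eq) (from-to b))

inverse : ∀ {n} → CAut n → CAut n
inverse ψ = record
  { to = from ; from = to ; to-from = from-to ; from-to = to-from
  ; adj⇒ = λ a b d → adj⇐ (from a) (from b) (subst₂ CAdj (sym (to-from a)) (sym (to-from b)) d)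
  ; adj⇐ = λ a b d → subst₂ CAdj (to-from a) (to-from b) (adj⇒ (from a) (from b) d) }
  where open CAut ψ

infixr 9 _∘ᴬ_

_∘ᴬ_ : ∀ {n} → CAut n → CAut n → CAut n
φ ∘ᴬ ψ = record
  { to = λ x → F.to (G.to x) ; from = λ x → G.from (F.from x)
  ; to-from = λ v → trans (cong F.to (G.to-from (F.from v))) (F.to-from v)
  ; from-to = λ v → trans (cong G.from (F.from-to (G.to v))) (G.from-to v)
  ; adj⇒ = λ a b d → F.adj⇒ _ _ (G.adj⇒ a b d)
  ; adj⇐ = λ a b d → G.adj⇐ a b (F.adj⇐ _ _ d) }
  where module F = CAut φ
        module G = CAut ψ

translation : ∀ {n} → Vertex n → CAut n
translation t = record
  { to = t ⊕_ ; from = t ⊕_ ; to-from = ⊕-cancelˡ t ; from-to = ⊕-cancelˡ t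
  ; adj⇒ = λ a b d → subst Gen (sym (⊕-translation t a b)) d
  ; adj⇐ = λ a b d → subst Gen (⊕-translation t a b) d }

involution-aut : ∀ {n} (f : Vertex n → Vertex n) → (∀ x → f (f x) ≡ x)
               → (∀ x y → f (x ⊕ y) ≡ f x ⊕ f y) → (∀ {x} → Gen x → Gen (f x)) → CAut n
involution-aut f f-invol f-⊕ f-Gen = record
  { to = f ; from = f ; to-from = f-invol ; from-to = f-invol
  ; adj⇒ = λ a b d → subst Gen (f-⊕ a b) (f-Gen d)
  ; adj⇐ = λ a b d → subst Gen (f-invol (a ⊕ b)) (f-Gen (subst Gen (sym (f-⊕ a b)) d)) }

identityᴬ : ∀ {n} → CAut n
identityᴬ = record
  { to = λ x → x ; from = λ x → x ; to-from = λ _ → refl ; from-to = λ _ → refl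
  ; adj⇒ = λ _ _ d → d ; adj⇐ = λ _ _ d → d }

when : ∀ {n} → Bool → CAut n → CAut n
when true g = g
when false g = identityᴬ

when-fixes : ∀ {n} a {g : CAut n} {x} → CAut.to g x ≡ x → CAut.to (when a g) x ≡ x
when-fixes true gx = gx
when-fixes false gx = refl

-- From AQₙ to the Cayley graph

data IsUnit : ∀ {n} → Vertex n → Set where
  first : ∀ {n} {x : Vertex n} → IsZero x → IsUnit (true ∷ x)
  skip : ∀ {n} {x : Vertex n} → IsUnit x → IsUnit (false ∷ x)

data AllOnes : ∀ {n} → Vertex n → Set where
  ones[] : AllOnes []
  one∷ : ∀ {n} {x : Vertex n} → AllOnes x → AllOnes (true ∷ x)

data IsOnesSuffix : ∀ {n} → Vertex n → Set where
  ones₂ : ∀ {n} {x : Vertex n} → AllOnes x → IsOnesSuffix (true ∷ true ∷ x)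
  skip : ∀ {n} {x : Vertex n} → IsOnesSuffix x → IsOnesSuffix (false ∷ x)

≢⇒xor≡true : ∀ {a b} → a ≢ b → a xor b ≡ true
≢⇒xor≡true {false} {false} a≢b = ⊥-elim (a≢b refl)
≢⇒xor≡true {false} {true} _ = refl
≢⇒xor≡true {true} {false} _ = refl
≢⇒xor≡true {true} {true} a≢b = ⊥-elim (a≢b refl)

≡⇒xor≡false : ∀ {a b} → a ≡ b → a xor b ≡ false
≡⇒xor≡false {a} refl = xor-same a

xor≡true⇒≢ : ∀ {a b} → a xor b ≡ true → a ≢ b
xor≡true⇒≢ {a} eq refl = true≢false (trans (sym eq) (xor-same a))

xor≡false⇒≡ : ∀ {a b} → a xor b ≡ false → a ≡ b
xor≡false⇒≡ {false} {false} _ = refl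
xor≡false⇒≡ {true} {true} _ = refl

xor-cancelˡ : ∀ a b → a xor (a xor b) ≡ b
xor-cancelˡ a b = trans (sym (xor-assoc a a b)) (cong (_xor b) (xor-same a))

lookup-ext : ∀ {n} {a b : Vertex n} → (∀ i → lookup a i ≡ lookup b i) → a ≡ b
lookup-ext {a = a} {b} h = trans (sym (tabulate∘lookup a)) (trans (tabulate-cong h) (tabulate∘lookup b))

DifferInOne⇒IsUnit : ∀ {n} (a b : Vertex n) → DifferInOne a b → IsUnit (a ⊕ b)
DifferInOne⇒IsUnit (x ∷ a) (y ∷ b) (fzero , ne , rest) =
  subst IsUnit (cong (_∷ (a ⊕ b)) (sym (≢⇒xor≡true ne)))
    (first (≡𝟎⇒IsZero (trans (cong (_⊕ b) (lookup-ext (λ j → rest (fsuc j) (λ ())))) (⊕-self b))))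
DifferInOne⇒IsUnit (x ∷ a) (y ∷ b) (fsuc i , ne , rest) =
  subst IsUnit (cong (_∷ (a ⊕ b)) (sym (≡⇒xor≡false (rest fzero (λ ())))))
    (skip (DifferInOne⇒IsUnit a b (i , ne , λ j j≢i → rest (fsuc j) (λ eq → j≢i (Fin.suc-injective eq)))))

IsUnit⇒DifferInOne : ∀ {n} (a b : Vertex n) → IsUnit (a ⊕ b) → DifferInOne a b
IsUnit⇒DifferInOne (x ∷ a) (y ∷ b) p with x xor y in eq
IsUnit⇒DifferInOne (x ∷ a) (y ∷ b) (first z) | true =
  fzero , xor≡true⇒≢ eq , λ { fzero j≢ → ⊥-elim (j≢ refl)
                     ; (fsuc j) _ → cong (λ v → lookup v j) (⊕≡𝟎⇒≡ (IsZero⇒≡𝟎 z)) }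
IsUnit⇒DifferInOne (x ∷ a) (y ∷ b) (skip p) | false with IsUnit⇒DifferInOne a b p
... | i , ne , rest = fsuc i , ne , λ { fzero _ → xor≡false⇒≡ eq
                                     ; (fsuc j) j≢ → rest j (λ e → j≢ (cong fsuc e)) }

≢⇒AllOnes : ∀ {n} (a b : Vertex n) → (∀ i → lookup a i ≢ lookup b i) → AllOnes (a ⊕ b)
≢⇒AllOnes [] [] _ = ones[]
≢⇒AllOnes (x ∷ a) (y ∷ b) h = subst AllOnes (cong (_∷ (a ⊕ b)) (sym (≢⇒xor≡true (h fzero)))) (one∷ (≢⇒AllOnes a b (λ i → h (fsuc i))))

ComplementEdge⇒IsOnesSuffix : ∀ {n} (a b : Vertex n) → ComplementEdge a b → IsOnesSuffix (a ⊕ b)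
ComplementEdge⇒IsOnesSuffix (x ∷ y ∷ a) (x′ ∷ y′ ∷ b) (zero , _ , _ , differ) =
  subst IsOnesSuffix (cong₂ (λ u w → u ∷ w ∷ (a ⊕ b)) (sym (≢⇒xor≡true (differ fzero z≤n))) (sym (≢⇒xor≡true (differ (fsuc fzero) z≤n))))
    (ones₂ (≢⇒AllOnes a b (λ i → differ (fsuc (fsuc i)) z≤n)))
ComplementEdge⇒IsOnesSuffix (x ∷ []) (y ∷ []) (zero , s≤s () , _)
ComplementEdge⇒IsOnesSuffix (x ∷ a) (y ∷ b) (suc ℓ , s≤s le , agree , differ) =
  subst IsOnesSuffix (cong (_∷ (a ⊕ b)) (sym (≡⇒xor≡false (agree fzero (s≤s z≤n)))))
    (skip (ComplementEdge⇒IsOnesSuffix a b (ℓ , le , (λ i lt → agree (fsuc i) (s≤s lt)) , λ i le′ → differ (fsuc i) (s≤s le′))))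

AllOnes⇒≢ : ∀ {n} (a b : Vertex n) → AllOnes (a ⊕ b) → ∀ i → lookup a i ≢ lookup b i
AllOnes⇒≢ (x ∷ a) (y ∷ b) p fzero with x xor y in eq
AllOnes⇒≢ (x ∷ a) (y ∷ b) (one∷ p) fzero | true = xor≡true⇒≢ eq
AllOnes⇒≢ (x ∷ a) (y ∷ b) p (fsuc i) with x xor y
AllOnes⇒≢ (x ∷ a) (y ∷ b) (one∷ p) (fsuc i) | true = AllOnes⇒≢ a b p i

IsOnesSuffix⇒ComplementEdge : ∀ {n} (a b : Vertex n) → IsOnesSuffix (a ⊕ b) → ComplementEdge a b
IsOnesSuffix⇒ComplementEdge (x ∷ a) (y ∷ b) p with x xor y in eq₀
IsOnesSuffix⇒ComplementEdge (x ∷ a) (y ∷ b) (skip p) | false with IsOnesSuffix⇒ComplementEdge a b p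
... | ℓ , le , agree , differ = suc ℓ , s≤s le ,
  (λ { fzero _ → xor≡false⇒≡ eq₀ ; (fsuc i) (s≤s lt) → agree i lt }) ,
  λ { fzero () ; (fsuc i) (s≤s le′) → differ i le′ }
IsOnesSuffix⇒ComplementEdge (x ∷ y ∷ a) (x′ ∷ y′ ∷ b) p | true with y xor y′ in eq₁
IsOnesSuffix⇒ComplementEdge (x ∷ y ∷ a) (x′ ∷ y′ ∷ b) (ones₂ o) | true | true =
  zero , s≤s (s≤s z≤n) , (λ i ()) ,
  λ { fzero _ → xor≡true⇒≢ eq₀ ; (fsuc fzero) _ → xor≡true⇒≢ eq₁ ; (fsuc (fsuc i)) _ → AllOnes⇒≢ a b o i }

δ-from : ∀ {n} → Bool → Vertex n → Vertex n
δ-from p [] = []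
δ-from p (x ∷ xs) = (p xor x) ∷ δ-from x xs

σ-from : ∀ {n} → Bool → Vertex n → Vertex n
σ-from p [] = []
σ-from p (c ∷ cs) = (p xor c) ∷ σ-from (p xor c) cs

δ : ∀ {n} → Vertex n → Vertex n
δ = δ-from false

σ : ∀ {n} → Vertex n → Vertex n
σ = σ-from false

σ-δ-from : ∀ {n} p (x : Vertex n) → σ-from p (δ-from p x) ≡ x
σ-δ-from p [] = refl
σ-δ-from p (x ∷ xs) rewrite xor-cancelˡ p x = cong (x ∷_) (σ-δ-from x xs)

δ-σ-from : ∀ {n} p (c : Vertex n) → δ-from p (σ-from p c) ≡ c
δ-σ-from p [] = refl
δ-σ-from p (c ∷ cs) rewrite xor-cancelˡ p c = cong (c ∷_) (δ-σ-from (p xor c) cs)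

σ-δ : ∀ {n} (x : Vertex n) → σ (δ x) ≡ x
σ-δ = σ-δ-from false

δ-σ : ∀ {n} (x : Vertex n) → δ (σ x) ≡ x
δ-σ = δ-σ-from false

δ-from-⊕ : ∀ {n} p q (x y : Vertex n) → δ-from p x ⊕ δ-from q y ≡ δ-from (p xor q) (x ⊕ y)
δ-from-⊕ p q [] [] = refl
δ-from-⊕ p q (x ∷ xs) (y ∷ ys) = cong₂ _∷_ (interchange p x q y) (δ-from-⊕ x y xs ys)

δ-⊕ : ∀ {n} (x y : Vertex n) → δ x ⊕ δ y ≡ δ (x ⊕ y)
δ-⊕ = δ-from-⊕ false false

δ-IsZero : ∀ {n} {x : Vertex n} → IsZero x → IsZero (δ x)
δ-IsZero z[] = z[]
δ-IsZero (z∷ z) = z∷ (δ-IsZero z)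

δ-AllOnes : ∀ {n} {x : Vertex n} → AllOnes x → IsZero (δ-from true x)
δ-AllOnes ones[] = z[]
δ-AllOnes (one∷ o) = z∷ (δ-AllOnes o)

δ-IsZero⁻ : ∀ {n} (x : Vertex n) → IsZero (δ x) → IsZero x
δ-IsZero⁻ [] _ = z[]
δ-IsZero⁻ (false ∷ x) (z∷ z) = z∷ (δ-IsZero⁻ x z)

δ-AllOnes⁻ : ∀ {n} (x : Vertex n) → IsZero (δ-from true x) → AllOnes x
δ-AllOnes⁻ [] _ = ones[]
δ-AllOnes⁻ (true ∷ x) (z∷ z) = one∷ (δ-AllOnes⁻ x z)

IsUnit⊎IsOnesSuffix⇒Gen-δ : ∀ {n} {x : Vertex n} → IsUnit x ⊎ IsOnesSuffix x → Gen (δ x)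
IsUnit⊎IsOnesSuffix⇒Gen-δ (inj₁ (first z[])) = unit₀ z[]
IsUnit⊎IsOnesSuffix⇒Gen-δ (inj₁ (first (z∷ z))) = pair₀ (δ-IsZero z)
IsUnit⊎IsOnesSuffix⇒Gen-δ (inj₁ (skip e)) = shift (IsUnit⊎IsOnesSuffix⇒Gen-δ (inj₁ e))
IsUnit⊎IsOnesSuffix⇒Gen-δ (inj₂ (ones₂ o)) = unit₀ (z∷ (δ-AllOnes o))
IsUnit⊎IsOnesSuffix⇒Gen-δ (inj₂ (skip s)) = shift (IsUnit⊎IsOnesSuffix⇒Gen-δ (inj₂ s))

Gen-δ⇒IsUnit⊎IsOnesSuffix : ∀ {n} (x : Vertex n) → Gen (δ x) → IsUnit x ⊎ IsOnesSuffix x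
Gen-δ⇒IsUnit⊎IsOnesSuffix (false ∷ x) (shift d) with Gen-δ⇒IsUnit⊎IsOnesSuffix x d
... | inj₁ e = inj₁ (skip e)
... | inj₂ s = inj₂ (skip s)
Gen-δ⇒IsUnit⊎IsOnesSuffix (true ∷ []) _ = inj₁ (first z[])
Gen-δ⇒IsUnit⊎IsOnesSuffix (true ∷ true ∷ x) (unit₀ (z∷ z)) = inj₂ (ones₂ (δ-AllOnes⁻ x z))
Gen-δ⇒IsUnit⊎IsOnesSuffix (true ∷ false ∷ x) (pair₀ z) = inj₁ (first (z∷ (δ-IsZero⁻ x z)))

Adj⇒CAdj-δ : ∀ {n} (a b : Vertex n) → Adj a b → CAdj (δ a) (δ b)
Adj⇒CAdj-δ a b h = subst Gen (sym (δ-⊕ a b)) (IsUnit⊎IsOnesSuffix⇒Gen-δ (f h))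
  where f : Adj a b → IsUnit (a ⊕ b) ⊎ IsOnesSuffix (a ⊕ b)
        f (inj₁ d) = inj₁ (DifferInOne⇒IsUnit a b d)
        f (inj₂ c) = inj₂ (ComplementEdge⇒IsOnesSuffix a b c)

CAdj-δ⇒Adj : ∀ {n} (a b : Vertex n) → CAdj (δ a) (δ b) → Adj a b
CAdj-δ⇒Adj a b d with Gen-δ⇒IsUnit⊎IsOnesSuffix (a ⊕ b) (subst Gen (δ-⊕ a b) d)
... | inj₁ e = inj₁ (IsUnit⇒DifferInOne a b e)
... | inj₂ s = inj₂ (IsOnesSuffix⇒ComplementEdge a b s)

toCAut : ∀ {n} → Automorphism n → CAut n
toCAut φ = record
  { to = λ x → δ (to (σ x)) ; from = λ x → δ (from (σ x))
  ; to-from = λ v → trans (cong (λ w → δ (to w)) (σ-δ _)) (trans (cong δ (to-from (σ v))) (δ-σ v))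
  ; from-to = λ v → trans (cong (λ w → δ (from w)) (σ-δ _)) (trans (cong δ (from-to (σ v))) (δ-σ v))
  ; adj⇒ = λ a b d → Adj⇒CAdj-δ _ _ (adj⇒ (σ a) (σ b) (CAdj-δ⇒Adj (σ a) (σ b) (subst₂ CAdj (sym (δ-σ a)) (sym (δ-σ b)) d)))
  ; adj⇐ = λ a b d → subst₂ CAdj (δ-σ a) (δ-σ b) (Adj⇒CAdj-δ (σ a) (σ b) (adj⇐ (σ a) (σ b) (CAdj-δ⇒Adj _ _ d))) }
  where open Automorphism φ

fromCAut : ∀ {n} → CAut n → Automorphism n
fromCAut ψ = record
  { to = λ x → σ (to (δ x)) ; from = λ x → σ (from (δ x))
  ; to-from = λ v → trans (cong (λ w → σ (to w)) (δ-σ _)) (trans (cong σ (to-from (δ v))) (σ-δ v))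
  ; from-to = λ v → trans (cong (λ w → σ (from w)) (δ-σ _)) (trans (cong σ (from-to (δ v))) (σ-δ v))
  ; adj⇒ = λ a b h → CAdj-δ⇒Adj _ _ (subst₂ CAdj (sym (δ-σ _)) (sym (δ-σ _)) (adj⇒ (δ a) (δ b) (Adj⇒CAdj-δ a b h)))
  ; adj⇐ = λ a b h → CAdj-δ⇒Adj a b (adj⇐ (δ a) (δ b) (subst₂ CAdj (δ-σ _) (δ-σ _) (Adj⇒CAdj-δ _ _ h))) }
  where open CAut ψ

IsDeterminingᶜ : ∀ n → List (Vertex n) → Set
IsDeterminingᶜ n S = ∀ (ψ : CAut n) → (∀ v → v ∈ S → CAut.to ψ v ≡ v) → ∀ v → CAut.to ψ v ≡ v

DetNumberᶜ : ℕ → ℕ → Set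
DetNumberᶜ n k =
  (Σ (List (Vertex n)) λ S → Unique S × length S ≡ k × IsDeterminingᶜ n S)
  × (∀ (S : List (Vertex n)) → Unique S → IsDeterminingᶜ n S → k ≤ length S)

σ-injective : ∀ {n} {x y : Vertex n} → σ x ≡ σ y → x ≡ y
σ-injective {x = x} {y} eq = trans (sym (δ-σ x)) (trans (cong δ eq) (δ-σ y))

δ-injective : ∀ {n} {x y : Vertex n} → δ x ≡ δ y → x ≡ y
δ-injective {x = x} {y} eq = trans (sym (σ-δ x)) (trans (cong σ eq) (σ-δ y))

DetNumberᶜ⇒DetNumber : ∀ {n k} → DetNumberᶜ n k → DetNumber n k
DetNumberᶜ⇒DetNumber {n} {k} ((S , uS , lS , dS) , low) =
  (map σ S , Unique-map⁺ σ-injective uS , trans (length-map σ S) lS , det) , low'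
  where
    det : IsDetermining n (map σ S)
    det φ fix v = subst (λ w → to w ≡ v) (σ-δ v) (δ-injective (dS (toCAut φ) fixP (δ v)))
      where
        open Automorphism φ
        fixP : ∀ w → w ∈ S → δ (to (σ w)) ≡ w
        fixP w w∈ = trans (cong δ (fix (σ w) (∈-map⁺ σ w∈))) (δ-σ w)
    low' : ∀ T → Unique T → IsDetermining n T → k ≤ length T
    low' T uT dT = subst (k ≤_) (length-map δ T) (low (map δ T) (Unique-map⁺ δ-injective uT) detT)
      where
        detT : IsDeterminingᶜ n (map δ T)
        detT ψ fix v = subst (λ w → to w ≡ v) (δ-σ v) (σ-injective (dT (fromCAut ψ) fixA (σ v)))
          where
            open CAut ψ
            fixA : ∀ w → w ∈ T → σ (to (δ w)) ≡ w
            fixA w w∈ = trans (cong σ (fix (δ w) (∈-map⁺ δ w∈))) (σ-δ w)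

-- Conjugating g by the translation by a turns the fixed vertices a ⊕ s of g into fixed vertices s.
¬determining : ∀ {n} (g : CAut n) {x} → CAut.to g 𝟎 ≡ 𝟎 → CAut.to g x ≢ x
             → ∀ a S → (∀ s → s ∈ S → CAut.to g (a ⊕ s) ≡ a ⊕ s) → ¬ IsDeterminingᶜ n (a ∷ S)
¬determining g {x} g𝟎 moved a S fixes det = moved (begin
    to x                                 ≡˘⟨ ⊕-cancelˡ a (to x) ⟩
    a ⊕ (a ⊕ to x)                       ≡⟨ cong (a ⊕_) (subst (λ y → a ⊕ to y ≡ a ⊕ x) (⊕-cancelˡ a x) (det ψ fixes-a∷S (a ⊕ x))) ⟩
    a ⊕ (a ⊕ x)                          ≡⟨ ⊕-cancelˡ a x ⟩
    x                                    ∎)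
  where
    open CAut g
    ψ = translation a ∘ᴬ g ∘ᴬ translation a
    fixes-a∷S : ∀ v → v ∈ a ∷ S → CAut.to ψ v ≡ v
    fixes-a∷S v (here refl) = trans (cong (λ y → a ⊕ to y) (⊕-self a)) (trans (cong (a ⊕_) g𝟎) (⊕-identityʳ a))
    fixes-a∷S v (there v∈S) = trans (cong (a ⊕_) (fixes v v∈S)) (⊕-cancelˡ a v)

Gen-e : ∀ {n} i → i < n → Gen (e {n} i)
Gen-e {suc n} zero _ = unit₀ IsZero-𝟎
Gen-e {suc n} (suc i) (s≤s lt) = shift (Gen-e i lt)

Gen-pair : ∀ {n} i → suc i < n → Gen (pair {n} i)
Gen-pair {suc (suc n)} zero _ = pair₀ (≡𝟎⇒IsZero (⊕-identityʳ 𝟎))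
Gen-pair {suc n} (suc i) (s≤s lt) = shift (Gen-pair i lt)

pair-0 : ∀ {n} → pair {suc (suc n)} 0 ≡ true ∷ true ∷ 𝟎
pair-0 = cong (λ w → true ∷ true ∷ w) (⊕-identityʳ 𝟎)

GenForm : ∀ {n} → Vertex n → Set
GenForm {n} x = (Σ ℕ λ i → i < n × x ≡ e i) ⊎ (Σ ℕ λ i → suc i < n × x ≡ pair i)

Gen-char : ∀ {n} {x : Vertex n} → Gen x → GenForm x
Gen-char {suc n} (unit₀ z) = inj₁ (0 , s≤s z≤n , cong (true ∷_) (IsZero⇒≡𝟎 z))
Gen-char {suc (suc n)} (pair₀ z) = inj₂ (0 , s≤s (s≤s z≤n) , trans (cong (λ w → true ∷ true ∷ w) (IsZero⇒≡𝟎 z)) (sym pair-0))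
Gen-char {suc n} (shift d) with Gen-char d
... | inj₁ (i , lt , eq) = inj₁ (suc i , s≤s lt , cong (false ∷_) eq)
... | inj₂ (i , lt , eq) = inj₂ (suc i , s≤s lt , cong (false ∷_) eq)

¬Gen-IsZero : ∀ {n} {x : Vertex n} → IsZero x → ¬ Gen x
¬Gen-IsZero (z∷ z) (shift d) = ¬Gen-IsZero z d

Gen⇒≢𝟎 : ∀ {n} {x : Vertex n} → Gen x → x ≢ 𝟎
Gen⇒≢𝟎 d eq = ¬Gen-IsZero (≡𝟎⇒IsZero eq) d

Gen-ones-consecutive : ∀ {n} {x : Vertex n} → Gen x → ∀ k k′ → bit x k ≡ true → bit x k′ ≡ true → k < k′ → k′ ≡ suc k
Gen-ones-consecutive (unit₀ z) zero (suc k′) _ b′ _ = ⊥-elim (¬bit-IsZero z b′)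
Gen-ones-consecutive (unit₀ z) (suc k) _ b _ _ = ⊥-elim (¬bit-IsZero z b)
Gen-ones-consecutive (pair₀ z) zero (suc zero) _ _ _ = refl
Gen-ones-consecutive (pair₀ z) zero (suc (suc k′)) _ b′ _ = ⊥-elim (¬bit-IsZero z b′)
Gen-ones-consecutive (pair₀ z) (suc zero) (suc zero) _ _ (s≤s ())
Gen-ones-consecutive (pair₀ z) (suc zero) (suc (suc k′)) _ b′ _ = ⊥-elim (¬bit-IsZero z b′)
Gen-ones-consecutive (pair₀ z) (suc (suc k)) _ b _ _ = ⊥-elim (¬bit-IsZero z b)
Gen-ones-consecutive (shift d) (suc k) (suc k′) b b′ (s≤s lt) = cong suc (Gen-ones-consecutive d k k′ b b′ lt)

Gen-head-bits : ∀ {n} {y : Vertex n} → Gen (true ∷ y) → ∀ k → bit y (suc k) ≡ false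
Gen-head-bits (unit₀ z) k = bit-IsZero z (suc k)
Gen-head-bits (pair₀ z) k = bit-IsZero z k

Gen-head : ∀ {n} {y : Vertex (suc n)} → Gen (true ∷ y) → IsZero y ⊎ Σ (Vertex n) λ z → y ≡ true ∷ z × IsZero z
Gen-head (unit₀ z) = inj₁ z
Gen-head (pair₀ z) = inj₂ (_ , refl , z)

bit-e⊕e-left : ∀ {n} i j → i < n → i ≢ j → bit (e {n} i ⊕ e j) i ≡ true
bit-e⊕e-left {n} i j lt ne = trans (bit-⊕ (e {n} i) (e j) i) (cong₂ _xor_ (bit-e-same {n} i lt) (bit-e-other {n} j i (ne ∘ sym)))

bit-e⊕e-right : ∀ {n} i j → j < n → i ≢ j → bit (e {n} i ⊕ e j) j ≡ true
bit-e⊕e-right {n} i j lt ne = trans (bit-⊕ (e {n} i) (e j) j) (cong₂ _xor_ (bit-e-other {n} i j ne) (bit-e-same {n} j lt))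

bit-pair-hi : ∀ {n} i → suc i < n → bit (pair {n} i) (suc i) ≡ true
bit-pair-hi i lt = bit-e⊕e-right i (suc i) lt (λ ())

bit-pair-lo : ∀ {n} i → i < n → bit (pair {n} i) i ≡ true
bit-pair-lo i lt = bit-e⊕e-left i (suc i) lt (λ ())

bit-pair-out : ∀ {n} i k → i ≢ k → suc i ≢ k → bit (pair {n} i) k ≡ false
bit-pair-out {n} i k ne ne′ = trans (bit-⊕ (e {n} i) (e (suc i)) k) (cong₂ _xor_ (bit-e-other {n} i k ne) (bit-e-other {n} (suc i) k ne′))

Gen-units-consecutive : ∀ {n} i j → i < j → j < n → Gen (e {n} i ⊕ e j) → j ≡ suc i
Gen-units-consecutive i j i<j j<n d =
  Gen-ones-consecutive d i j (bit-e⊕e-left i j (<-trans i<j j<n) (<⇒≢ i<j)) (bit-e⊕e-right i j j<n (<⇒≢ i<j)) i<j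

¬Gen-far-units : ∀ {n} i j → suc i < j → j < n → ¬ Gen (e {n} i ⊕ e j)
¬Gen-far-units i j i+1<j j<n d with Gen-units-consecutive i j (<⇒≤ i+1<j) j<n d
... | refl = <-irrefl refl i+1<j

¬Gen-e₀⊕far-pair : ∀ {n} j → 0 < j → suc j < n → ¬ Gen (e {n} 0 ⊕ pair j)
¬Gen-e₀⊕far-pair {n} j 0<j j+1<n d with Gen-ones-consecutive d 0 (suc j) bit-0 bit-j+1 (s≤s z≤n)
  where
    bit-0 = trans (bit-⊕ (e {n} 0) (pair j) 0) (cong₂ _xor_ (bit-e-same {n} 0 (<-trans (s≤s z≤n) j+1<n)) (bit-pair-out {n} j 0 (λ j≡0 → <⇒≢ 0<j (sym j≡0)) (λ ())))
    bit-j+1 = trans (bit-⊕ (e {n} 0) (pair j) (suc j)) (cong₂ _xor_ (bit-e-other {n} 0 (suc j) (λ ())) (bit-pair-hi j j+1<n))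
... | refl = <-irrefl refl 0<j

UniqueSplit : ∀ {n} → Vertex n → Vertex n → Set
UniqueSplit {n} a b = ∀ (c : Vertex n) → Gen c → Gen (c ⊕ (a ⊕ b)) → c ≡ a ⊎ c ≡ b

split-peel : ∀ {m} (c : Vertex (suc m)) (g : Vertex m) k → Gen c → Gen (c ⊕ (false ∷ g)) → bit g (suc k) ≡ true
           → Σ (Vertex m) λ c′ → c ≡ false ∷ c′ × Gen c′ × Gen (c′ ⊕ g)
split-peel (false ∷ c′) g k (shift d) (shift d′) _ = c′ , refl , d , d′
split-peel (true ∷ z) g k (unit₀ zz) dd b =
  ⊥-elim (true≢false (trans (sym b) (trans (sym (bit-IsZero-⊕ zz g (suc k))) (Gen-head-bits dd k))))
split-peel (true ∷ true ∷ z) g k (pair₀ zz) dd b =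
  ⊥-elim (true≢false (trans (sym b) (trans (sym (trans (bit-⊕ (true ∷ z) g (suc k)) (cong (_xor bit g (suc k)) (bit-IsZero zz k))))
                                           (Gen-head-bits dd k))))

split-head : ∀ {m} (c : Vertex (suc m)) (g : Vertex m) → Gen c → Gen (c ⊕ (true ∷ g))
           → (c ≡ e 0 × Gen g) ⊎ (c ≡ pair 0 × Gen (e 0 ⊕ g)) ⊎ (c ≡ false ∷ g × Gen g) ⊎ (c ≡ false ∷ (e 0 ⊕ g) × Gen (e 0 ⊕ g))
split-head (true ∷ z) g (unit₀ zz) (shift d) = inj₁ (cong (true ∷_) (IsZero⇒≡𝟎 zz) , subst Gen (IsZero-⊕ zz g) d)
split-head (true ∷ true ∷ z) g (pair₀ zz) (shift d) =
  inj₂ (inj₁ (trans (cong (λ w → true ∷ true ∷ w) (IsZero⇒≡𝟎 zz)) (sym pair-0) , subst (λ w → Gen (w ⊕ g)) (cong (true ∷_) (IsZero⇒≡𝟎 zz)) d))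
split-head {zero} (false ∷ []) [] (shift ()) _
split-head {suc m} (false ∷ c′) g (shift d) dd with Gen-head dd
... | inj₁ z = inj₂ (inj₂ (inj₁ (cong (false ∷_) c′≡g , subst Gen c′≡g d)))
  where c′≡g = ⊕≡𝟎⇒≡ (IsZero⇒≡𝟎 z)
... | inj₂ (w , c′⊕g≡1w , z) = inj₂ (inj₂ (inj₂ (cong (false ∷_) c′≡e₀⊕g , subst Gen c′≡e₀⊕g d)))
  where c′≡e₀⊕g = ⊕-solveʳ (trans c′⊕g≡1w (cong (true ∷_) (IsZero⇒≡𝟎 z)))

split-pair : ∀ {n} i → suc i < n → UniqueSplit (e {n} i) (e (suc i))
split-pair {suc m} (suc i) (s≤s lt) c dc dd with split-peel c (pair i) i dc dd (bit-pair-hi i lt)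
... | c′ , refl , d′ , dd′ = Sum.map (cong (false ∷_)) (cong (false ∷_)) (split-pair i lt c′ d′ dd′)
split-pair {suc zero} zero (s≤s ())
split-pair {suc (suc m)} zero _ c dc dd with split-head c (e 0) dc (subst (λ g → Gen (c ⊕ g)) pair-0 dd)
... | inj₁ (eq , _) = inj₁ eq
... | inj₂ (inj₁ (_ , d)) = ⊥-elim (Gen⇒≢𝟎 d (⊕-self (e 0)))
... | inj₂ (inj₂ (inj₁ (eq , _))) = inj₂ eq
... | inj₂ (inj₂ (inj₂ (_ , d))) = ⊥-elim (Gen⇒≢𝟎 d (⊕-self (e 0)))

split-far-units : ∀ {n} i j → 3 + i ≤ j → j < n → UniqueSplit (e {n} i) (e j)
split-far-units {suc m} (suc i) (suc (suc k)) (s≤s i+3≤k+1) (s≤s lt) c dc dd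
  with split-peel c (e i ⊕ e (suc k)) k dc dd (bit-e⊕e-right i (suc k) lt (<⇒≢ (≤-trans (≤-trans (n≤1+n _) (n≤1+n _)) i+3≤k+1)))
... | c′ , refl , d′ , dd′ = Sum.map (cong (false ∷_)) (cong (false ∷_)) (split-far-units i (suc k) i+3≤k+1 lt c′ d′ dd′)
split-far-units {suc m} zero (suc j) (s≤s 2≤j) (s≤s lt) c dc dd
  with split-head c (e j) dc (subst (λ g → Gen (c ⊕ (true ∷ g))) (⊕-identityˡ (e j)) dd)
... | inj₁ (eq , _) = inj₁ eq
... | inj₂ (inj₁ (_ , d)) = ⊥-elim (¬Gen-far-units 0 j 2≤j lt d)
... | inj₂ (inj₂ (inj₁ (eq , _))) = inj₂ eq
... | inj₂ (inj₂ (inj₂ (_ , d))) = ⊥-elim (¬Gen-far-units 0 j 2≤j lt d)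

split-unit-far-pair : ∀ {n} i j → 2 + i ≤ j → suc j < n → UniqueSplit (e {n} i) (pair j)
split-unit-far-pair {suc m} (suc i) (suc (suc k)) (s≤s i+2≤k+1) (s≤s lt) c dc dd
  with split-peel c (e i ⊕ pair (suc k)) (suc k) dc dd hi
  where
    hi = trans (bit-⊕ (e {m} i) (pair (suc k)) (suc (suc k)))
           (cong₂ _xor_ (bit-e-other {m} i _ (<⇒≢ (≤-trans (n≤1+n _) (≤-trans i+2≤k+1 (n≤1+n _))))) (bit-pair-hi (suc k) lt))
... | c′ , refl , d′ , dd′ = Sum.map (cong (false ∷_)) (cong (false ∷_)) (split-unit-far-pair i (suc k) i+2≤k+1 lt c′ d′ dd′)
split-unit-far-pair {suc m} zero (suc j) (s≤s 1≤j) (s≤s lt) c dc dd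
  with split-head c (pair j) dc (subst (λ g → Gen (c ⊕ (true ∷ g))) (⊕-identityˡ (pair j)) dd)
... | inj₁ (eq , _) = inj₁ eq
... | inj₂ (inj₁ (_ , d)) = ⊥-elim (¬Gen-e₀⊕far-pair j 1≤j lt d)
... | inj₂ (inj₂ (inj₁ (eq , _))) = inj₂ eq
... | inj₂ (inj₂ (inj₂ (_ , d))) = ⊥-elim (¬Gen-e₀⊕far-pair j 1≤j lt d)

split-pair-far-unit : ∀ {n} i j → 3 + i ≤ j → j < n → UniqueSplit (pair {n} i) (e j)
split-pair-far-unit {suc m} (suc i) (suc (suc k)) (s≤s i+3≤k+1) (s≤s lt) c dc dd
  with split-peel c (pair i ⊕ e (suc k)) k dc dd hi
  where
    i+1<k+1 = ≤-trans (n≤1+n _) i+3≤k+1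
    hi = trans (bit-⊕ (pair {m} i) (e (suc k)) (suc k))
           (cong₂ _xor_ (bit-pair-out {m} i (suc k) (<⇒≢ (≤-trans (n≤1+n _) i+1<k+1)) (<⇒≢ i+1<k+1)) (bit-e-same {m} (suc k) lt))
... | c′ , refl , d′ , dd′ = Sum.map (cong (false ∷_)) (cong (false ∷_)) (split-pair-far-unit i (suc k) i+3≤k+1 lt c′ d′ dd′)
split-pair-far-unit {suc (suc m)} zero (suc j) (s≤s 2≤j) (s≤s lt) c dc dd
  with split-head c (e 0 ⊕ e j) dc (subst (λ g → Gen (c ⊕ (true ∷ g))) (cong (_⊕ e j) (⊕-identityˡ (e 0))) dd)
... | inj₁ (_ , d) = ⊥-elim (¬Gen-far-units 0 j 2≤j lt d)
... | inj₂ (inj₁ (eq , _)) = inj₁ eq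
... | inj₂ (inj₂ (inj₁ (_ , d))) = ⊥-elim (¬Gen-far-units 0 j 2≤j lt d)
... | inj₂ (inj₂ (inj₂ (eq , _))) = inj₂ (trans eq (cong (false ∷_) (⊕-cancelˡ (e 0) (e j))))

split-e : ∀ {n} j (c : Vertex n) → Gen c → Gen (c ⊕ e j) → j < n
        → (c ≡ e (suc j) ⊎ c ≡ pair j) ⊎ Σ ℕ λ j′ → j ≡ suc j′ × (c ≡ e j′ ⊎ c ≡ pair j′)
split-e {suc zero} zero (true ∷ []) (unit₀ z[]) (shift ()) _
split-e {suc (suc m)} zero c dc dd _ with split-head c 𝟎 dc dd
... | inj₁ (_ , d) = ⊥-elim (Gen⇒≢𝟎 d refl)
... | inj₂ (inj₁ (eq , _)) = inj₁ (inj₂ eq)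
... | inj₂ (inj₂ (inj₁ (_ , d))) = ⊥-elim (Gen⇒≢𝟎 d refl)
... | inj₂ (inj₂ (inj₂ (eq , _))) = inj₁ (inj₁ (trans eq (cong (false ∷_) (⊕-identityʳ (e 0)))))
split-e {suc m} (suc j) (false ∷ c′) (shift dc) (shift dd) (s≤s lt) with split-e j c′ dc dd lt
... | inj₁ r = inj₁ (Sum.map (cong (false ∷_)) (cong (false ∷_)) r)
... | inj₂ (j′ , refl , r) = inj₂ (suc j′ , refl , Sum.map (cong (false ∷_)) (cong (false ∷_)) r)
split-e {suc (suc m)} (suc j) (true ∷ z) (unit₀ zz) dd (s≤s lt) with Gen-head {y = z ⊕ e j} dd
... | inj₁ zz′ = ⊥-elim (e≢𝟎 j lt (trans (sym (IsZero-⊕ zz (e j))) (IsZero⇒≡𝟎 zz′)))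
... | inj₂ (w , z⊕e≡1w , wz) with e-injective j 0 lt (trans (sym (IsZero-⊕ zz (e j))) (trans z⊕e≡1w (cong (true ∷_) (IsZero⇒≡𝟎 wz))))
...   | refl = inj₂ (0 , refl , inj₁ (cong (true ∷_) (IsZero⇒≡𝟎 zz)))
split-e {suc (suc m)} (suc j) (true ∷ true ∷ z) (pair₀ zz) dd (s≤s lt) with Gen-head {y = (true ∷ z) ⊕ e j} dd
... | inj₁ zz′ with e-injective j 0 lt (trans (sym (⊕≡𝟎⇒≡ (IsZero⇒≡𝟎 zz′))) (cong (true ∷_) (IsZero⇒≡𝟎 zz)))
...   | refl = inj₂ (0 , refl , inj₂ (trans (cong (λ w → true ∷ true ∷ w) (IsZero⇒≡𝟎 zz)) (sym pair-0)))
split-e {suc (suc m)} (suc j) (true ∷ true ∷ z) (pair₀ zz) dd (s≤s lt) | inj₂ (w , 1z⊕e≡1w , wz) =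
  ⊥-elim (e≢𝟎 j lt (trans (⊕-solveˡ 1z⊕e≡1w) (cong (false ∷_) (trans (cong₂ _⊕_ (IsZero⇒≡𝟎 zz) (IsZero⇒≡𝟎 wz)) (⊕-self 𝟎)))))

-- Reversal and the end swaps

bit-∷ʳ-< : ∀ {n} (x : Vertex n) b k → k < n → bit (x ∷ʳ b) k ≡ bit x k
bit-∷ʳ-< (a ∷ x) b zero _ = refl
bit-∷ʳ-< (a ∷ x) b (suc k) (s≤s lt) = bit-∷ʳ-< x b k lt

bit-∷ʳ-last : ∀ {n} (x : Vertex n) b → bit (x ∷ʳ b) n ≡ b
bit-∷ʳ-last [] b = refl
bit-∷ʳ-last (a ∷ x) b = bit-∷ʳ-last x b

∸-suc : ∀ {m n} → n < m → m ∸ n ≡ suc (m ∸ suc n)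
∸-suc {suc m} {zero} _ = refl
∸-suc {suc m} {suc n} (s≤s lt) = ∸-suc lt

bit-reverse : ∀ {n} (x : Vertex n) k → k < n → bit (reverse x) k ≡ bit x (n ∸ suc k)
bit-reverse {suc n} (a ∷ x) k (s≤s k≤n) rewrite reverse-∷ a x with k <? n
... | yes k<n = trans (bit-∷ʳ-< (reverse x) a k k<n)
                  (trans (bit-reverse x k k<n) (cong (bit (a ∷ x)) (sym (∸-suc k<n))))
... | no k≮n with ≤-antisym k≤n (≮⇒≥ k≮n)
... | refl = trans (bit-∷ʳ-last (reverse x) a) (cong (bit (a ∷ x)) (sym (n∸n≡0 k)))

⊕-∷ʳ : ∀ {n} (x y : Vertex n) a b → (x ∷ʳ a) ⊕ (y ∷ʳ b) ≡ (x ⊕ y) ∷ʳ (a xor b)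
⊕-∷ʳ [] [] a b = refl
⊕-∷ʳ (c ∷ x) (d ∷ y) a b = cong ((c xor d) ∷_) (⊕-∷ʳ x y a b)

reverse-⊕ : ∀ {n} (x y : Vertex n) → reverse (x ⊕ y) ≡ reverse x ⊕ reverse y
reverse-⊕ [] [] = refl
reverse-⊕ (a ∷ x) (b ∷ y) = begin
  reverse ((a xor b) ∷ (x ⊕ y))          ≡⟨ reverse-∷ (a xor b) (x ⊕ y) ⟩
  reverse (x ⊕ y) ∷ʳ (a xor b)           ≡⟨ cong (_∷ʳ (a xor b)) (reverse-⊕ x y) ⟩
  (reverse x ⊕ reverse y) ∷ʳ (a xor b)   ≡⟨ sym (⊕-∷ʳ (reverse x) (reverse y) a b) ⟩
  (reverse x ∷ʳ a) ⊕ (reverse y ∷ʳ b)    ≡⟨ sym (cong₂ _⊕_ (reverse-∷ a x) (reverse-∷ b y)) ⟩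
  reverse (a ∷ x) ⊕ reverse (b ∷ y)      ∎

𝟎-∷ʳ-false : ∀ {n} → 𝟎 {n} ∷ʳ false ≡ 𝟎
𝟎-∷ʳ-false {zero} = refl
𝟎-∷ʳ-false {suc n} = cong (false ∷_) 𝟎-∷ʳ-false

𝟎-∷ʳ-true : ∀ {n} → 𝟎 {n} ∷ʳ true ≡ e n
𝟎-∷ʳ-true {zero} = refl
𝟎-∷ʳ-true {suc n} = cong (false ∷_) 𝟎-∷ʳ-true

e-∷ʳ-false : ∀ {n} i → i < n → e {n} i ∷ʳ false ≡ e i
e-∷ʳ-false {suc n} zero _ = cong (true ∷_) 𝟎-∷ʳ-false
e-∷ʳ-false {suc n} (suc i) (s≤s lt) = cong (false ∷_) (e-∷ʳ-false i lt)

reverse-𝟎 : ∀ {n} → reverse (𝟎 {n}) ≡ 𝟎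
reverse-𝟎 {zero} = refl
reverse-𝟎 {suc n} = trans (reverse-∷ false 𝟎) (trans (cong (_∷ʳ false) reverse-𝟎) 𝟎-∷ʳ-false)

reverse-e : ∀ {n} i → i < n → reverse (e {n} i) ≡ e (n ∸ suc i)
reverse-e {suc n} zero _ = trans (reverse-∷ true 𝟎) (trans (cong (_∷ʳ true) reverse-𝟎) 𝟎-∷ʳ-true)
reverse-e {suc n} (suc i) (s≤s lt) =
  trans (reverse-∷ false (e i)) (trans (cong (_∷ʳ false) (reverse-e i lt)) (e-∷ʳ-false _ (∸-monoʳ-< {o = 0} (s≤s z≤n) lt)))

Gen-∷ʳ-false : ∀ {n} {x : Vertex n} → Gen x → Gen (x ∷ʳ false)
Gen-∷ʳ-false (unit₀ z) = unit₀ (≡𝟎⇒IsZero (trans (cong (_∷ʳ false) (IsZero⇒≡𝟎 z)) 𝟎-∷ʳ-false))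
Gen-∷ʳ-false (pair₀ z) = pair₀ (≡𝟎⇒IsZero (trans (cong (_∷ʳ false) (IsZero⇒≡𝟎 z)) 𝟎-∷ʳ-false))
Gen-∷ʳ-false (shift d) = shift (Gen-∷ʳ-false d)

Gen-𝟎-∷ʳ-true : ∀ {n} → Gen (𝟎 {n} ∷ʳ true)
Gen-𝟎-∷ʳ-true {zero} = unit₀ z[]
Gen-𝟎-∷ʳ-true {suc n} = shift Gen-𝟎-∷ʳ-true

Gen-𝟎-∷ʳ-true-∷ʳ-true : ∀ {n} → Gen ((𝟎 {n} ∷ʳ true) ∷ʳ true)
Gen-𝟎-∷ʳ-true-∷ʳ-true {zero} = pair₀ z[]
Gen-𝟎-∷ʳ-true-∷ʳ-true {suc n} = shift Gen-𝟎-∷ʳ-true-∷ʳ-true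

Gen-reverse : ∀ {n} {x : Vertex n} → Gen x → Gen (reverse x)
Gen-reverse (unit₀ {x = x} z) =
  subst Gen (sym (trans (reverse-∷ true x) (cong (λ y → reverse y ∷ʳ true) (IsZero⇒≡𝟎 z))))
    (subst (λ y → Gen (y ∷ʳ true)) (sym reverse-𝟎) Gen-𝟎-∷ʳ-true)
Gen-reverse (pair₀ {x = x} z) =
  subst Gen (sym (trans (reverse-∷ true (true ∷ x)) (cong (_∷ʳ true) (trans (reverse-∷ true x) (cong (λ y → reverse y ∷ʳ true) (IsZero⇒≡𝟎 z))))))
    (subst (λ y → Gen ((y ∷ʳ true) ∷ʳ true)) (sym reverse-𝟎) Gen-𝟎-∷ʳ-true-∷ʳ-true)
Gen-reverse (shift {x = x} d) = subst Gen (sym (reverse-∷ false x)) (Gen-∷ʳ-false (Gen-reverse d))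

reversal : ∀ {n} → CAut n
reversal = involution-aut reverse reverse-involutive reverse-⊕ Gen-reverse

front : ∀ {n} → Vertex n → Vertex n
front [] = []
front (a ∷ []) = a ∷ []
front (a ∷ b ∷ x) = a ∷ (a xor b) ∷ x

front-involutive : ∀ {n} (x : Vertex n) → front (front x) ≡ x
front-involutive [] = refl
front-involutive (a ∷ []) = refl
front-involutive (a ∷ b ∷ x) = cong (λ c → a ∷ c ∷ x) (trans (sym (xor-assoc a a b)) (cong (_xor b) (xor-same a)))

front-⊕ : ∀ {n} (x y : Vertex n) → front (x ⊕ y) ≡ front x ⊕ front y
front-⊕ [] [] = refl
front-⊕ (a ∷ []) (c ∷ []) = refl
front-⊕ (a ∷ b ∷ x) (c ∷ d ∷ y) = cong (λ t → (a xor c) ∷ t ∷ (x ⊕ y)) (interchange a c b d)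

Gen-front : ∀ {n} {x : Vertex n} → Gen x → Gen (front x)
Gen-front (unit₀ z[]) = unit₀ z[]
Gen-front (unit₀ (z∷ z)) = pair₀ z
Gen-front (pair₀ z) = unit₀ (z∷ z)
Gen-front {suc (suc n)} (shift {x = b ∷ x} d) = shift d

frontSwap : ∀ {n} → CAut n
frontSwap = involution-aut front front-involutive front-⊕ Gen-front

bit-front-1 : ∀ {n} (x : Vertex (suc (suc n))) → bit (front x) 1 ≡ bit x 0 xor bit x 1
bit-front-1 (a ∷ b ∷ x) = refl

bit-front-other : ∀ {n} (x : Vertex n) k → k ≢ 1 → bit (front x) k ≡ bit x k
bit-front-other [] k ne = refl
bit-front-other (a ∷ []) k ne = refl
bit-front-other (a ∷ b ∷ x) zero ne = refl
bit-front-other (a ∷ b ∷ x) (suc zero) ne = ⊥-elim (ne refl)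
bit-front-other (a ∷ b ∷ x) (suc (suc k)) ne = refl

front-fixes : ∀ {n} (x : Vertex n) → bit x 0 ≡ false → front x ≡ x
front-fixes [] _ = refl
front-fixes (a ∷ []) _ = refl
front-fixes (false ∷ b ∷ x) _ = refl

back : ∀ {n} → Vertex n → Vertex n
back x = reverse (front (reverse x))

backSwap : ∀ {n} → CAut n
backSwap = reversal ∘ᴬ frontSwap ∘ᴬ reversal

module BackBits {p : ℕ} where
  private
    N = suc (suc p)

    mirror-involutive : ∀ {k} → k < N → N ∸ suc (suc p ∸ k) ≡ k
    mirror-involutive {k} (s≤s k≤p+1) = trans (cong (N ∸_) (sym (∸-suc (s≤s k≤p+1)))) (m∸[m∸n]≡n (≤-trans k≤p+1 (n≤1+n _)))

    mirror≡1 : ∀ {k} → k < N → suc p ∸ k ≡ 1 → k ≡ p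
    mirror≡1 {k} (s≤s k≤p+1) eq = trans (sym (m∸[m∸n]≡n k≤p+1)) (cong (suc p ∸_) eq)

  bit-back : ∀ (x : Vertex N) k → k < N → bit (back x) k ≡ bit (front (reverse x)) (suc p ∸ k)
  bit-back x k lt = bit-reverse (front (reverse x)) k lt

  bit-back-other : ∀ (x : Vertex N) k → k ≢ p → bit (back x) k ≡ bit x k
  bit-back-other x k k≢p with k <? N
  ... | no k≮N = trans (bit-out (back x) k (≮⇒≥ k≮N)) (sym (bit-out x k (≮⇒≥ k≮N)))
  ... | yes k<N = begin
    bit (back x) k                          ≡⟨ bit-back x k k<N ⟩
    bit (front (reverse x)) (suc p ∸ k)     ≡⟨ bit-front-other (reverse x) _ (λ eq → k≢p (mirror≡1 k<N eq)) ⟩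
    bit (reverse x) (suc p ∸ k)             ≡⟨ bit-reverse x _ (s≤s (m∸n≤m (suc p) k)) ⟩
    bit x (N ∸ suc (suc p ∸ k))             ≡⟨ cong (bit x) (mirror-involutive k<N) ⟩
    bit x k                                 ∎

  bit-back-at : ∀ (x : Vertex N) → bit (back x) p ≡ bit x (suc p) xor bit x p
  bit-back-at x = begin
    bit (back x) p                                ≡⟨ bit-back x p (n≤1+n _) ⟩
    bit (front (reverse x)) (suc p ∸ p)           ≡⟨ cong (bit (front (reverse x))) (m+n∸n≡m 1 p) ⟩
    bit (front (reverse x)) 1                     ≡⟨ bit-front-1 (reverse x) ⟩
    bit (reverse x) 0 xor bit (reverse x) 1       ≡⟨ cong₂ _xor_ (bit-reverse x 0 (s≤s z≤n)) (bit-reverse x 1 (s≤s (s≤s z≤n))) ⟩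
    bit x (suc p) xor bit x p                     ∎

  back-fixes : ∀ (x : Vertex N) → bit x (suc p) ≡ false → back x ≡ x
  back-fixes x last≡false = bit-ext bits
    where
      bits : ∀ k → bit (back x) k ≡ bit x k
      bits k with k ≟ p
      ... | yes refl = trans (bit-back-at x) (cong (_xor bit x k) last≡false)
      ... | no k≢p = bit-back-other x k k≢p

symmetry : ∀ {n} → Bool → Bool → Bool → CAut n
symmetry r a b = when b backSwap ∘ᴬ when a frontSwap ∘ᴬ when r reversal

-- Automorphisms fixing 𝟎

CommonNeighbour : ∀ {n} → Vertex n → Vertex n → Set
CommonNeighbour x w = Gen w × Gen (w ⊕ x)

Rich : ∀ {n} → Vertex n → Set
Rich {n} x = Σ (Vertex n) λ w₁ → Σ (Vertex n) λ w₂ → Σ (Vertex n) λ w₃ →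
  (CommonNeighbour x w₁ × CommonNeighbour x w₂ × CommonNeighbour x w₃) × (w₁ ≢ w₂ × w₁ ≢ w₃ × w₂ ≢ w₃)

¬Rich-two-candidates : ∀ {n} {x a b : Vertex n} → (∀ w → CommonNeighbour x w → w ≡ a ⊎ w ≡ b) → ¬ Rich x
¬Rich-two-candidates h (w₁ , w₂ , w₃ , (c₁ , c₂ , c₃) , (w₁≢w₂ , w₁≢w₃ , w₂≢w₃))
  with h w₁ c₁ | h w₂ c₂ | h w₃ c₃
... | inj₁ refl | inj₁ refl | _ = w₁≢w₂ refl
... | inj₂ refl | inj₂ refl | _ = w₁≢w₂ refl
... | inj₁ refl | _ | inj₁ refl = w₁≢w₃ refl
... | inj₂ refl | _ | inj₂ refl = w₁≢w₃ refl
... | _ | inj₁ refl | inj₁ refl = w₂≢w₃ refl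
... | _ | inj₂ refl | inj₂ refl = w₂≢w₃ refl

module FixingZero {n} (ψ : CAut n) (fix0 : CAut.to ψ 𝟎 ≡ 𝟎) where
  open CAut ψ

  Fixed : Vertex n → Set
  Fixed x = to x ≡ x

  Gen-preserved : ∀ {x} → Gen x → Gen (to x)
  Gen-preserved {x} d = subst Gen (trans (cong (_⊕ to x) fix0) (⊕-identityˡ (to x)))
                                  (adj⇒ 𝟎 x (subst Gen (sym (⊕-identityˡ x)) d))

  Rich-preserved : ∀ {x} → Rich x → Rich (to x)
  Rich-preserved {x} (w₁ , w₂ , w₃ , (c₁ , c₂ , c₃) , (w₁≢w₂ , w₁≢w₃ , w₂≢w₃)) =
    to w₁ , to w₂ , to w₃ , (image c₁ , image c₂ , image c₃) ,
    (λ eq → w₁≢w₂ (to-injective eq)) , (λ eq → w₁≢w₃ (to-injective eq)) , (λ eq → w₂≢w₃ (to-injective eq))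
    where
      image : ∀ {w} → CommonNeighbour x w → CommonNeighbour (to x) (to w)
      image {w} (dw , dwx) = Gen-preserved dw , adj⇒ w x dwx

  from-𝟎 : from 𝟎 ≡ 𝟎
  from-𝟎 = trans (cong from (sym fix0)) (from-to 𝟎)

  neighbour-of-fixed : ∀ {x y} → Gen (x ⊕ y) → Fixed y → Gen (to x ⊕ y)
  neighbour-of-fixed {x} {y} d fy = subst (λ t → Gen (to x ⊕ t)) fy (adj⇒ x y d)

  -- The image of a ⊕ (b ⊕ r) is adjacent to the fixed vertices b ⊕ r and a ⊕ r; the two generators by
  -- which it differs from them sum to a ⊕ b, so by uniqueness of that split it is a ⊕ (b ⊕ r) itself or r.
  complete-square : ∀ a b r → Gen a → Gen b → UniqueSplit a b
                  → Fixed r → Fixed (a ⊕ r) → Fixed (b ⊕ r) → Fixed (a ⊕ (b ⊕ r))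
  complete-square a b r da db split fr far fbr with split c c-Gen (subst Gen c⊕a⊕b c′-Gen)
    where
      z = a ⊕ (b ⊕ r)
      c = to z ⊕ (b ⊕ r)
      c-Gen : Gen c
      c-Gen = neighbour-of-fixed (subst Gen (sym (⊕-cancelʳ (b ⊕ r) a)) da) fbr
      c′-Gen : Gen (to z ⊕ (a ⊕ r))
      c′-Gen = neighbour-of-fixed (subst Gen (sym (trans (cong (_⊕ (a ⊕ r)) (⊕-swap a b r)) (⊕-cancelʳ (a ⊕ r) b))) db) far
      c⊕a⊕b : to z ⊕ (a ⊕ r) ≡ c ⊕ (a ⊕ b)
      c⊕a⊕b = sym (trans (⊕-assoc (to z) (b ⊕ r) (a ⊕ b)) (cong (to z ⊕_) (begin
        (b ⊕ r) ⊕ (a ⊕ b)  ≡⟨ cong₂ _⊕_ (⊕-comm b r) (⊕-comm a b) ⟩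
        (r ⊕ b) ⊕ (b ⊕ a)  ≡⟨ ⊕-telescope r b a ⟩
        r ⊕ a              ≡⟨ ⊕-comm r a ⟩
        a ⊕ r              ∎)))
  ... | inj₁ c≡a = ⊕-solveʳ c≡a
  ... | inj₂ c≡b = trans image≡r (sym (to-injective (trans image≡r (sym fr))))
    where image≡r : to (a ⊕ (b ⊕ r)) ≡ r
          image≡r = trans (⊕-solveʳ c≡b) (⊕-cancelˡ b r)

  fixed-split : ∀ {a b} → Gen a → Gen b → UniqueSplit a b → Fixed a → Fixed b → Fixed (a ⊕ b)
  fixed-split {a} {b} da db split fa fb =
    subst Fixed (cong (a ⊕_) (⊕-identityʳ b))
      (complete-square a b 𝟎 da db split fix0 (subst Fixed (sym (⊕-identityʳ a)) fa) (subst Fixed (sym (⊕-identityʳ b)) fb))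

  fixed-pair : ∀ {i} → suc i < n → Fixed (e i) → Fixed (e (suc i)) → Fixed (pair i)
  fixed-pair {i} lt = fixed-split (Gen-e i (<⇒≤ lt)) (Gen-e (suc i) lt) (split-pair i lt)

sumE : ∀ {n} → List ℕ → Vertex n
sumE [] = 𝟎
sumE (i ∷ L) = e i ⊕ sumE L

support : ∀ {n} → Vertex n → List ℕ
support [] = []
support (false ∷ x) = map suc (support x)
support (true ∷ x) = 0 ∷ map suc (support x)

sumE-map-suc : ∀ {n} (L : List ℕ) → sumE {suc n} (map suc L) ≡ false ∷ sumE L
sumE-map-suc [] = refl
sumE-map-suc (i ∷ L) = cong (e (suc i) ⊕_) (sumE-map-suc L)

sumE-support : ∀ {n} (x : Vertex n) → sumE (support x) ≡ x
sumE-support [] = refl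
sumE-support (false ∷ x) = trans (sumE-map-suc (support x)) (cong (false ∷_) (sumE-support x))
sumE-support (true ∷ x) =
  trans (cong (e 0 ⊕_) (sumE-map-suc (support x))) (cong (true ∷_) (trans (⊕-identityˡ _) (sumE-support x)))

support-increasing : ∀ {n} (x : Vertex n) → Linked _<_ (support x)
support-increasing [] = []
support-increasing (false ∷ x) = Linked.map⁺ (Linked.map s≤s (support-increasing x))
support-increasing (true ∷ x) with support x | support-increasing x
... | [] | _ = [-]
... | j ∷ L | r = s≤s z≤n ∷ Linked.map⁺ (Linked.map s≤s r)

support-bounded : ∀ {n} (x : Vertex n) → All (_< n) (support x)
support-bounded [] = []
support-bounded (false ∷ x) = All.map⁺ (All.map s≤s (support-bounded x))
support-bounded (true ∷ x) = s≤s z≤n ∷ All.map⁺ (All.map s≤s (support-bounded x))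

data Gap (i j : ℕ) : Set where
  gap₁ : j ≡ suc i → Gap i j
  gap₂ : j ≡ suc (suc i) → Gap i j
  gap₃ : 3 + i ≤ j → Gap i j

gap : ∀ i j → i < j → Gap i j
gap zero (suc zero) _ = gap₁ refl
gap zero (suc (suc zero)) _ = gap₂ refl
gap zero (suc (suc (suc j))) _ = gap₃ (s≤s (s≤s (s≤s z≤n)))
gap (suc i) (suc j) (s≤s lt) with gap i j lt
... | gap₁ eq = gap₁ (cong suc eq)
... | gap₂ eq = gap₂ (cong suc eq)
... | gap₃ le = gap₃ (s≤s le)

Linked-drop : ∀ {i j L} → Linked _<_ (i ∷ j ∷ L) → Linked _<_ (i ∷ L)
Linked-drop (_ ∷ [-]) = [-]
Linked-drop (i<j ∷ j<k ∷ r) = <-trans i<j j<k ∷ r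

module FixingGenerators {n} (n≥4 : 4 ≤ n) (ψ : CAut n) (fix0 : CAut.to ψ 𝟎 ≡ 𝟎)
                        (fixGen : ∀ {x} → Gen x → CAut.to ψ x ≡ x) where
  open CAut ψ
  open FixingZero ψ fix0

  fixed-e : ∀ {i} → i < n → Fixed (e i)
  fixed-e {i} lt = fixGen (Gen-e i lt)

  fixed-e⊕𝟎 : ∀ {i} → i < n → Fixed (e i ⊕ 𝟎)
  fixed-e⊕𝟎 {i} lt = subst Fixed (sym (⊕-identityʳ (e i))) (fixed-e lt)

  fixed-far-units : ∀ {i j} → 3 + i ≤ j → j < n → Fixed (e i ⊕ e j)
  fixed-far-units {i} {j} le lt =
    fixed-split (Gen-e i i<n) (Gen-e j lt) (split-far-units i j le lt) (fixed-e i<n) (fixed-e lt)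
    where i<n = ≤-trans (≤-trans (n≤1+n _) (≤-trans (n≤1+n _) le)) (<⇒≤ lt)

  -- A vertex eᵢ ⊕ (eⱼ ⊕ r), with i < j the two lowest positions of its support, completes a square whose
  -- other corners have smaller support. This needs eᵢ ⊕ eⱼ to split uniquely into generators, which fails
  -- for j = i + 2 (it is also pair i ⊕ pair (i + 1)); then the third position, eⱼ₊₁ or eᵢ₋₁ is used instead.
  fixed-sum : ∀ k L → length L ≤ k → Linked _<_ L → All (_< n) L → Fixed (sumE L)
  fixed-sum k [] _ _ _ = fix0
  fixed-sum k (i ∷ []) _ _ (i<n ∷ []) = fixed-e⊕𝟎 i<n
  fixed-sum (suc k) (i ∷ j ∷ R) (s≤s len) (i<j ∷ inc) (i<n ∷ j<n ∷ R<n) with gap i j i<j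
  ... | gap₁ refl =
    complete-square (e i) (e j) (sumE R) (Gen-e i i<n) (Gen-e j j<n) (split-pair i j<n)
      (fixed-sum k R (≤-trans (n≤1+n _) len) (Linked.tail inc) R<n)
      (fixed-sum k (i ∷ R) len (Linked-drop (i<j ∷ inc)) (i<n ∷ R<n))
      (fixed-sum k (j ∷ R) len inc (j<n ∷ R<n))
  ... | gap₃ far =
    complete-square (e i) (e j) (sumE R) (Gen-e i i<n) (Gen-e j j<n) (split-far-units i j far j<n)
      (fixed-sum k R (≤-trans (n≤1+n _) len) (Linked.tail inc) R<n)
      (fixed-sum k (i ∷ R) len (Linked-drop (i<j ∷ inc)) (i<n ∷ R<n))
      (fixed-sum k (j ∷ R) len inc (j<n ∷ R<n))
  fixed-sum (suc k) (i ∷ j ∷ l ∷ R) (s≤s len) (i<j ∷ j<l ∷ inc) (i<n ∷ j<n ∷ l<n ∷ R<n) | gap₂ refl =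
    subst Fixed (cong (e i ⊕_) (⊕-swap (e l) (e j) (sumE R)))
      (complete-square (e i) (e l) (sumE (j ∷ R)) (Gen-e i i<n) (Gen-e l l<n)
        (split-far-units i l j<l l<n)
        (fixed-sum k (j ∷ R) (≤-trans (n≤1+n _) len) (Linked-drop (j<l ∷ inc)) (j<n ∷ R<n))
        (fixed-sum k (i ∷ j ∷ R) len (i<j ∷ Linked-drop (j<l ∷ inc)) (i<n ∷ j<n ∷ R<n))
        (subst Fixed (⊕-swap (e j) (e l) (sumE R)) (fixed-sum k (j ∷ l ∷ R) len (j<l ∷ inc) (j<n ∷ l<n ∷ R<n))))
  fixed-sum (suc k) (i ∷ j ∷ []) _ _ (i<n ∷ j<n ∷ []) | gap₂ refl with suc j <? n
  ... | yes j+1<n =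
    subst Fixed (cong (e i ⊕_) (trans (⊕-cancelʳ (e (suc j)) (e j)) (sym (⊕-identityʳ (e j)))))
      (complete-square (e i) (pair j) (e (suc j)) (Gen-e i i<n) (Gen-pair j j+1<n)
        (split-unit-far-pair i j ≤-refl j+1<n)
        (fixed-e j+1<n) (fixed-far-units ≤-refl j+1<n)
        (subst Fixed (sym (⊕-cancelʳ (e (suc j)) (e j))) (fixed-e j<n)))
  ... | no j+1≮n = fixed-last-gap₂ i j+1≮n i<n j<n
    where
      fixed-last-gap₂ : ∀ i → ¬ (3 + i < n) → i < n → 2 + i < n → Fixed (e i ⊕ (e (2 + i) ⊕ 𝟎))
      fixed-last-gap₂ zero i+3≮n _ _ = ⊥-elim (i+3≮n n≥4)
      fixed-last-gap₂ (suc i) _ i+1<n i+3<n =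
        subst Fixed square≡
          (complete-square (pair i) (e (3 + i)) (e i) (Gen-pair i i+1<n) (Gen-e (3 + i) i+3<n)
            (split-pair-far-unit i (3 + i) ≤-refl i+3<n)
            (fixed-e (<⇒≤ i+1<n))
            (subst Fixed (sym (trans (⊕-comm (pair i) (e i)) (⊕-cancelˡ (e i) (e (suc i))))) (fixed-e i+1<n))
            (subst Fixed (⊕-comm (e i) (e (3 + i))) (fixed-far-units ≤-refl i+3<n)))
        where
          square≡ : pair i ⊕ (e (3 + i) ⊕ e i) ≡ e (suc i) ⊕ (e (3 + i) ⊕ 𝟎)
          square≡ = begin
            (e i ⊕ e (suc i)) ⊕ (e (3 + i) ⊕ e i)  ≡⟨ cong₂ _⊕_ (⊕-comm (e i) _) (⊕-comm (e (3 + i)) (e i)) ⟩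
            (e (suc i) ⊕ e i) ⊕ (e i ⊕ e (3 + i))  ≡⟨ ⊕-telescope (e (suc i)) (e i) (e (3 + i)) ⟩
            e (suc i) ⊕ e (3 + i)                  ≡⟨ cong (e (suc i) ⊕_) (sym (⊕-identityʳ (e (3 + i)))) ⟩
            e (suc i) ⊕ (e (3 + i) ⊕ 𝟎)            ∎

  identity : ∀ x → Fixed x
  identity x = subst Fixed (sumE-support x)
    (fixed-sum _ (support x) ≤-refl (support-increasing x) (support-bounded x))

module RichUnits {p : ℕ} where
  private
    N = suc (suc p)

  ¬Rich-e₀ : ¬ Rich (e {N} 0)
  ¬Rich-e₀ = ¬Rich-two-candidates candidates
    where
      candidates : ∀ w → CommonNeighbour (e 0) w → w ≡ e 1 ⊎ w ≡ pair 0
      candidates w (dw , dwx) with split-e 0 w dw dwx (s≤s z≤n)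
      ... | inj₁ r = r

  ¬Rich-pair : ∀ {i} → suc i < N → ¬ Rich (pair {N} i)
  ¬Rich-pair {i} lt = ¬Rich-two-candidates λ w c → split-pair i lt w (proj₁ c) (proj₂ c)

  ¬Rich-last : ¬ Rich (e {N} (suc p))
  ¬Rich-last = ¬Rich-two-candidates candidates
    where
      e-beyond : e {N} (suc (suc p)) ≡ 𝟎
      e-beyond = e-out (suc (suc p)) ≤-refl
      candidates : ∀ w → CommonNeighbour (e (suc p)) w → w ≡ e p ⊎ w ≡ pair p
      candidates w (dw , dwx) with split-e (suc p) w dw dwx ≤-refl
      ... | inj₁ (inj₁ w≡e) = ⊥-elim (Gen⇒≢𝟎 dw (trans w≡e e-beyond))
      ... | inj₁ (inj₂ w≡pair) = ⊥-elim (Gen⇒≢𝟎 dwx (begin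
            w ⊕ e (suc p)                    ≡⟨ cong (_⊕ e (suc p)) (trans w≡pair (cong (e (suc p) ⊕_) e-beyond)) ⟩
            (e (suc p) ⊕ 𝟎) ⊕ e (suc p)      ≡⟨ cong (_⊕ e (suc p)) (⊕-identityʳ (e (suc p))) ⟩
            e (suc p) ⊕ e (suc p)            ≡⟨ ⊕-self (e (suc p)) ⟩
            𝟎                                ∎))
      ... | inj₂ (_ , refl , r) = r

  Rich-interior : ∀ {i} → suc (suc i) < N → Rich (e {N} (suc i))
  Rich-interior {i} i+2<N =
    e i , e (suc (suc i)) , pair (suc i) ,
    ( (Gen-e i i<N , Gen-pair i i+1<N)
    , (Gen-e (suc (suc i)) i+2<N , subst Gen (⊕-comm (e (suc i)) _) (Gen-pair (suc i) i+2<N))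
    , (Gen-pair (suc i) i+2<N , subst Gen (sym (⊕-cancelˡʳ (e (suc i)) _)) (Gen-e (suc (suc i)) i+2<N)) ) ,
    ( (λ eq → i≢i+2 (e-injective i _ i<N eq))
    , (λ eq → true≢false (trans (sym (bit-e-same {N} i i<N)) (trans (cong (λ x → bit x i) eq) (bit-pair-out {N} (suc i) i (λ ()) (λ ())))))
    , (λ eq → true≢false (trans (sym (bit-pair-lo {N} (suc i) i+1<N))
                           (trans (cong (λ x → bit x (suc i)) (sym eq)) (bit-e-other {N} (suc (suc i)) (suc i) (λ ()))))) )
    where
      i+1<N = <⇒≤ i+2<N
      i<N = <⇒≤ i+1<N
      i≢i+2 : i ≢ suc (suc i)
      i≢i+2 ()

  Rich-Gen⇒interior : ∀ {x} → Gen x → Rich x → Σ ℕ λ i → i < p × x ≡ e (suc i)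
  Rich-Gen⇒interior d rich with Gen-char d
  ... | inj₂ (i , lt , refl) = ⊥-elim (¬Rich-pair lt rich)
  ... | inj₁ (zero , _ , refl) = ⊥-elim (¬Rich-e₀ rich)
  ... | inj₁ (suc i , s≤s i<p+1 , refl) with i <? p
  ...   | yes i<p = i , i<p , refl
  ...   | no i≮p with ≤-antisym (≤-pred i<p+1) (≮⇒≥ i≮p)
  ...     | refl = ⊥-elim (¬Rich-last rich)

  Rich-neighbour : ∀ {x} j → Rich x → Gen x → Gen (x ⊕ e j) → j < N
                 → x ≡ e (suc j) ⊎ Σ ℕ λ j′ → j ≡ suc j′ × x ≡ e j′
  Rich-neighbour j rich d dj j<N with Rich-Gen⇒interior d rich
  ... | i , i<p , refl with suc i <? j
  ...   | yes i+1<j = inj₂ (suc i , Gen-units-consecutive (suc i) j i+1<j j<N dj , refl)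
  ...   | no i+1≮j with j <? suc i
  ...     | yes j<i+1 = inj₁ (cong e (Gen-units-consecutive j (suc i) j<i+1 (s≤s (≤-trans i<p (n≤1+n _)))
                                        (subst Gen (⊕-comm (e (suc i)) (e j)) dj)))
  ...     | no j≮i+1 with ≤-antisym (≮⇒≥ i+1≮j) (≮⇒≥ j≮i+1)
  ...       | refl = ⊥-elim (Gen⇒≢𝟎 dj (⊕-self (e (suc i))))

-- n ≥ 6

module AtLeastSix (q : ℕ) where
  p : ℕ
  p = 4 + q

  N : ℕ
  N = 2 + p

  open RichUnits {p}
  open BackBits {p}

  only-rich-neighbour-of-e₁ : ∀ {x} → Rich x → Gen x → Gen (x ⊕ e 1) → x ≡ e {N} 2
  only-rich-neighbour-of-e₁ rich d adj with Rich-neighbour 1 rich d adj (s≤s (s≤s z≤n))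
  ... | inj₁ x≡e₂ = x≡e₂
  ... | inj₂ (0 , refl , refl) = ⊥-elim (¬Rich-e₀ rich)

  module Walk (ψ : CAut N) (fix0 : CAut.to ψ 𝟎 ≡ 𝟎) where
    open CAut ψ
    open FixingZero ψ fix0

    rich-image : ∀ {i} → suc (suc i) < N → Rich (to (e (suc i)))
    rich-image lt = Rich-preserved (Rich-interior lt)

    image-interior : ∀ {i} → suc (suc i) < N → Gen (to (e (suc i)))
    image-interior lt = Gen-preserved (Gen-e _ (<⇒≤ lt))

    -- ψ⁻¹ would send both rich neighbours e (suc k) and e (3 + k) of ψ e₁ = e (2 + k) to e₂.
    image-e₁ : Fixed (e 1) ⊎ to (e 1) ≡ e p
    image-e₁ with Rich-Gen⇒interior (image-interior {0} (s≤s (s≤s (s≤s z≤n)))) (rich-image (s≤s (s≤s (s≤s z≤n))))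
    ... | zero , _ , eq = inj₁ eq
    ... | suc k , k+1<p , eq with suc (suc k) <? p
    ...   | no k+2≮p with ≤-antisym k+1<p (≮⇒≥ k+2≮p)
    ...     | refl = inj₂ eq
    image-e₁ | suc k , _ , eq | yes k+2<p =
      ⊥-elim (k+1≢k+3 (e-injective (suc k) _ (<⇒≤ (<⇒≤ k+3<N))
        (CAut.to-injective (inverse ψ) (trans (preimage≡e₂ below) (sym (preimage≡e₂ above))))))
      where
        k+3<N : suc (suc (suc k)) < N
        k+3<N = ≤-trans (s≤s k+2<p) (n≤1+n _)
        k+1≢k+3 : suc k ≢ suc (suc (suc k))
        k+1≢k+3 ()
        preimage≡e₂ : ∀ {i} → suc (suc i) < N × Gen (e (suc i) ⊕ e (suc (suc k))) → from (e (suc i)) ≡ e 2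
        preimage≡e₂ (lt , adj) = only-rich-neighbour-of-e₁
          (FixingZero.Rich-preserved (inverse ψ) from-𝟎 (Rich-interior lt))
          (FixingZero.Gen-preserved (inverse ψ) from-𝟎 (Gen-e _ (<⇒≤ lt)))
          (adj⇐ _ (e 1) (subst₂ CAdj (sym (to-from _)) (sym eq) adj))
        below : suc (suc k) < N × Gen (e (suc k) ⊕ e (suc (suc k)))
        below = <⇒≤ k+3<N , Gen-pair (suc k) (<⇒≤ k+3<N)
        above : suc (suc (suc (suc k))) < N × Gen (e (suc (suc (suc k))) ⊕ e (suc (suc k)))
        above = s≤s (s≤s k+2<p) , subst Gen (⊕-comm (e (suc (suc k))) _) (Gen-pair (suc (suc k)) k+3<N)

    module _ (fix1 : Fixed (e 1)) where
      private
        consecutive-fixed : ∀ i → suc i < p → Fixed (e (suc i)) × Fixed (e (suc (suc i)))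
        consecutive-fixed zero _ = fix1 , e₂-fixed
          where
            e₂-fixed : Fixed (e 2)
            e₂-fixed = only-rich-neighbour-of-e₁ (rich-image (s≤s (s≤s (s≤s (s≤s z≤n)))))
              (image-interior (s≤s (s≤s (s≤s (s≤s z≤n)))))
              (neighbour-of-fixed (subst Gen (⊕-comm (e 1) (e 2)) (Gen-pair 1 (s≤s (s≤s (s≤s z≤n))))) fix1)
        consecutive-fixed (suc i) i+2<p with consecutive-fixed i (≤-trans (n≤1+n _) i+2<p)
        ... | fixed-i+1 , fixed-i+2 = fixed-i+2 , fixed-i+3
          where
            i+3<N : suc (suc (suc i)) < N
            i+3<N = ≤-trans (s≤s i+2<p) (n≤1+n _)
            fixed-i+3 : Fixed (e (suc (suc (suc i))))
            fixed-i+3 with Rich-neighbour (suc (suc i)) (rich-image (s≤s (s≤s i+2<p))) (image-interior (s≤s (s≤s i+2<p)))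
                             (neighbour-of-fixed (subst Gen (⊕-comm (e (suc (suc i))) _) (Gen-pair (suc (suc i)) i+3<N)) fixed-i+2)
                             (<⇒≤ i+3<N)
            ... | inj₁ r = r
            ... | inj₂ (_ , refl , r) with e-injective (suc (suc (suc i))) (suc i) i+3<N (to-injective (trans r (sym fixed-i+1)))
            ...   | ()

      fixes-interior : ∀ {i} → i < p → Fixed (e (suc i))
      fixes-interior {zero} _ = fix1
      fixes-interior {suc i} i+1<p = proj₂ (consecutive-fixed i i+1<p)

  module Interior (ψ : CAut N) (fix0 : CAut.to ψ 𝟎 ≡ 𝟎)
                  (fixes-interior : ∀ {i} → i < p → CAut.to ψ (e (suc i)) ≡ e (suc i)) where
    open CAut ψ
    open FixingZero ψ fix0

    fixes-interior-pair : ∀ {i} → suc i < p → Fixed (pair (suc i))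
    fixes-interior-pair i+1<p = fixed-pair (≤-trans (s≤s i+1<p) (n≤1+n _)) (fixes-interior (<⇒≤ i+1<p)) (fixes-interior i+1<p)

    image-e₀ : Fixed (e 0) ⊎ to (e 0) ≡ pair 0
    image-e₀ with split-e 1 (to (e 0)) (Gen-preserved (Gen-e 0 (s≤s z≤n)))
                    (neighbour-of-fixed (Gen-pair 0 (s≤s (s≤s z≤n))) (fixes-interior (s≤s z≤n))) (s≤s (s≤s z≤n))
    ... | inj₁ (inj₁ r) with to-injective (trans r (sym (fixes-interior (s≤s (s≤s z≤n)))))
    ...   | ()
    image-e₀ | inj₁ (inj₂ r) with to-injective (trans r (sym (fixes-interior-pair (s≤s (s≤s z≤n)))))
    ...   | ()
    image-e₀ | inj₂ (0 , refl , r) = r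

    image-last : Fixed (e (suc p)) ⊎ to (e (suc p)) ≡ pair p
    image-last with split-e p (to (e (suc p))) (Gen-preserved (Gen-e _ ≤-refl))
                      (neighbour-of-fixed (subst Gen (⊕-comm (e p) _) (Gen-pair p ≤-refl)) (fixes-interior ≤-refl)) (n≤1+n _)
    ... | inj₁ r = r
    ... | inj₂ (_ , refl , inj₁ r) with e-injective (suc p) (3 + q) ≤-refl (to-injective (trans r (sym (fixes-interior {2 + q} (n≤1+n _)))))
    ...   | ()
    image-last | inj₂ (_ , refl , inj₂ r) = ⊥-elim (true≢false (begin
      true                                 ≡˘⟨ bit-e-same {N} (suc p) ≤-refl ⟩
      bit (e {N} (suc p)) (suc p)          ≡⟨ cong (λ x → bit x (suc p)) (to-injective (trans r (sym (fixes-interior-pair {2 + q} ≤-refl)))) ⟩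
      bit (pair {N} (3 + q)) (suc p)       ≡⟨ bit-pair-out {N} (3 + q) (suc p) (λ ()) (λ ()) ⟩
      false                                ∎))

    identity : Fixed (e 0) → Fixed (e (suc p)) → ∀ x → Fixed x
    identity fixed-e₀ fixed-last = FixingGenerators.identity (s≤s (s≤s (s≤s (s≤s z≤n)))) ψ fix0 fixes-generator
      where
        fixes-e : ∀ {i} → i < N → Fixed (e i)
        fixes-e {zero} _ = fixed-e₀
        fixes-e {suc i} (s≤s i<p+1) with i <? p
        ... | yes i<p = fixes-interior i<p
        ... | no i≮p with ≤-antisym (≤-pred i<p+1) (≮⇒≥ i≮p)
        ...   | refl = fixed-last
        fixes-generator : ∀ {x} → Gen x → Fixed x
        fixes-generator d with Gen-char d
        ... | inj₁ (i , lt , refl) = fixes-e lt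
        ... | inj₂ (i , lt , refl) = fixed-pair lt (fixes-e (<⇒≤ lt)) (fixes-e lt)

  front-pair₀ : front (pair {N} 0) ≡ e 0
  front-pair₀ = cong front pair-0

  front-interior : ∀ i → front (e {N} (suc i)) ≡ e (suc i)
  front-interior i = front-fixes _ (bit-e-other {N} (suc i) 0 (λ ()))

  back-e : ∀ {i} → i ≢ suc p → back (e {N} i) ≡ e i
  back-e {i} i≢last = back-fixes _ (bit-e-other {N} i (suc p) i≢last)

  back-𝟎 : back (𝟎 {N}) ≡ 𝟎
  back-𝟎 = back-fixes 𝟎 (bit-𝟎 {N} (suc p))

  reverse-e-p : reverse (e {N} p) ≡ e 1
  reverse-e-p = trans (reverse-e p (n≤1+n _)) (cong e (m+n∸n≡m 1 p))

  back-pair-last : back (pair {N} p) ≡ e (suc p)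
  back-pair-last = begin
    reverse (front (reverse (e p ⊕ e (suc p))))             ≡⟨ cong (λ x → reverse (front x)) (reverse-⊕ (e p) (e (suc p))) ⟩
    reverse (front (reverse (e p) ⊕ reverse (e (suc p))))   ≡⟨ cong (λ x → reverse (front (reverse (e p) ⊕ x))) (reverse-e (suc p) ≤-refl) ⟩
    reverse (front (reverse (e p) ⊕ e (N ∸ N)))             ≡⟨ cong (λ x → reverse (front (reverse (e p) ⊕ e x))) (n∸n≡0 N) ⟩
    reverse (front (reverse (e p) ⊕ e 0))                   ≡⟨ cong (λ x → reverse (front (x ⊕ e 0))) reverse-e-p ⟩
    reverse (front (e 1 ⊕ e 0))                             ≡⟨ cong (λ x → reverse (front x)) (⊕-comm (e 1) (e 0)) ⟩
    reverse (front (pair 0))                                ≡⟨ cong reverse front-pair₀ ⟩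
    reverse (e 0)                                           ≡⟨ reverse-e 0 (s≤s z≤n) ⟩
    e (suc p)                                               ∎

  private
    compose-fixes : ∀ a (g ψ : CAut N) {x} → CAut.to ψ x ≡ x → CAut.to g x ≡ x → CAut.to (when a g ∘ᴬ ψ) x ≡ x
    compose-fixes a g ψ ψx gx = trans (cong (CAut.to (when a g)) ψx) (when-fixes a gx)

  straighten-e₁ : (ψ : CAut N) → CAut.to ψ 𝟎 ≡ 𝟎 → Σ Bool λ r → CAut.to (when r reversal ∘ᴬ ψ) (e 1) ≡ e 1
  straighten-e₁ ψ fix0 with Walk.image-e₁ ψ fix0
  ... | inj₁ fixed = false , fixed
  ... | inj₂ moved = true , trans (cong reverse moved) reverse-e-p

  straighten-e₀ : (ψ : CAut N) (fix0 : CAut.to ψ 𝟎 ≡ 𝟎) (int : ∀ {i} → i < p → CAut.to ψ (e (suc i)) ≡ e (suc i))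
                → Σ Bool λ a → CAut.to (when a frontSwap ∘ᴬ ψ) (e 0) ≡ e 0
  straighten-e₀ ψ fix0 int with Interior.image-e₀ ψ fix0 int
  ... | inj₁ fixed = false , fixed
  ... | inj₂ moved = true , trans (cong front moved) front-pair₀

  straighten-last : (ψ : CAut N) (fix0 : CAut.to ψ 𝟎 ≡ 𝟎) (int : ∀ {i} → i < p → CAut.to ψ (e (suc i)) ≡ e (suc i))
                  → Σ Bool λ b → CAut.to (when b backSwap ∘ᴬ ψ) (e (suc p)) ≡ e (suc p)
  straighten-last ψ fix0 int with Interior.image-last ψ fix0 int
  ... | inj₁ fixed = false , fixed
  ... | inj₂ moved = true , trans (cong back moved) back-pair-last

  classification : (ψ : CAut N) → CAut.to ψ 𝟎 ≡ 𝟎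
                 → Σ Bool λ r → Σ Bool λ a → Σ Bool λ b → ∀ x → CAut.to (symmetry r a b) (CAut.to ψ x) ≡ x
  classification ψ fix0 = r , a , b , Interior.identity ψ₃ fix0₃ int₃ e₀-fixed₃ last-fixed₃
    where
      r = proj₁ (straighten-e₁ ψ fix0)
      ψ₁ = when r reversal ∘ᴬ ψ
      fix0₁ = compose-fixes r reversal ψ fix0 reverse-𝟎
      int₁ : ∀ {i} → i < p → CAut.to ψ₁ (e (suc i)) ≡ e (suc i)
      int₁ = Walk.fixes-interior ψ₁ fix0₁ (proj₂ (straighten-e₁ ψ fix0))
      a = proj₁ (straighten-e₀ ψ₁ fix0₁ int₁)
      ψ₂ = when a frontSwap ∘ᴬ ψ₁
      fix0₂ = compose-fixes a frontSwap ψ₁ fix0₁ (front-fixes 𝟎 refl)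
      int₂ : ∀ {i} → i < p → CAut.to ψ₂ (e (suc i)) ≡ e (suc i)
      int₂ {i} lt = compose-fixes a frontSwap ψ₁ (int₁ lt) (front-interior i)
      b = proj₁ (straighten-last ψ₂ fix0₂ int₂)
      ψ₃ = when b backSwap ∘ᴬ ψ₂
      fix0₃ = compose-fixes b backSwap ψ₂ fix0₂ back-𝟎
      int₃ : ∀ {i} → i < p → CAut.to ψ₃ (e (suc i)) ≡ e (suc i)
      int₃ lt = compose-fixes b backSwap ψ₂ (int₂ lt) (back-e (λ eq → <-irrefl (suc-injective eq) lt))
      e₀-fixed₃ = compose-fixes b backSwap ψ₂ (proj₂ (straighten-e₀ ψ₁ fix0₁ int₁)) (back-e {0} (λ ()))
      last-fixed₃ = proj₂ (straighten-last ψ₂ fix0₂ int₂)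

  witness : Vertex N
  witness = true ∷ false ∷ true ∷ (𝟎 ∷ʳ true)

  private
    bit-witness-p : bit witness p ≡ false
    bit-witness-p = trans (bit-∷ʳ-< 𝟎 true (suc q) ≤-refl) (bit-𝟎 {2 + q} (suc q))

    bit-witness-last : bit witness (suc p) ≡ true
    bit-witness-last = bit-∷ʳ-last (𝟎 {2 + q}) true

    bit-witness-mirror-2 : bit (reverse witness) 2 ≡ false
    bit-witness-mirror-2 = trans (bit-reverse witness 2 (s≤s (s≤s (s≤s z≤n))))
                             (trans (bit-∷ʳ-< 𝟎 true q (n≤1+n _)) (bit-𝟎 {2 + q} q))

    bit-when-front : ∀ a (x : Vertex N) k → k ≢ 1 → bit (CAut.to (when a frontSwap) x) k ≡ bit x k
    bit-when-front true x k k≢1 = bit-front-other x k k≢1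
    bit-when-front false x k k≢1 = refl

    bit-when-back : ∀ b (x : Vertex N) k → k ≢ p → bit (CAut.to (when b backSwap) x) k ≡ bit x k
    bit-when-back true x k k≢p = bit-back-other x k k≢p
    bit-when-back false x k k≢p = refl

  symmetry-fixing-witness : ∀ r a b → CAut.to (symmetry r a b) witness ≡ witness → r ≡ false × a ≡ false × b ≡ false
  symmetry-fixing-witness true a b fixed = ⊥-elim (true≢false (begin
    bit witness 2                                                          ≡˘⟨ cong (λ x → bit x 2) fixed ⟩
    bit (CAut.to (symmetry true a b) witness) 2                            ≡⟨ bit-when-back b _ 2 (λ ()) ⟩
    bit (CAut.to (when a frontSwap) (reverse witness)) 2                   ≡⟨ bit-when-front a _ 2 (λ ()) ⟩
    bit (reverse witness) 2                                                ≡⟨ bit-witness-mirror-2 ⟩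
    false                                                                  ∎))
  symmetry-fixing-witness false true b fixed = ⊥-elim (true≢false (begin
    bit (front witness) 1                                                  ≡˘⟨ bit-when-back b _ 1 (λ ()) ⟩
    bit (CAut.to (symmetry false true b) witness) 1                        ≡⟨ cong (λ x → bit x 1) fixed ⟩
    false                                                                  ∎))
  symmetry-fixing-witness false false true fixed = ⊥-elim (true≢false (begin
    true                                                                   ≡˘⟨ cong₂ _xor_ bit-witness-last bit-witness-p ⟩
    bit witness (suc p) xor bit witness p                                  ≡˘⟨ bit-back-at witness ⟩
    bit (back witness) p                                                   ≡⟨ cong (λ x → bit x p) fixed ⟩
    bit witness p                                                          ≡⟨ bit-witness-p ⟩
    false                                                                  ∎))
  symmetry-fixing-witness false false false _ = refl , refl , refl

  𝟎-witness-determining : IsDeterminingᶜ N (𝟎 ∷ witness ∷ [])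
  𝟎-witness-determining ψ fixes = from-classification (classification ψ (fixes 𝟎 (here refl)))
    where
      from-classification : (Σ Bool λ r → Σ Bool λ a → Σ Bool λ b → ∀ x → CAut.to (symmetry r a b) (CAut.to ψ x) ≡ x)
                          → ∀ x → CAut.to ψ x ≡ x
      from-classification (r , a , b , undo) = trivial undo (symmetry-fixing-witness r a b fixes-witness)
        where
          fixes-witness : CAut.to (symmetry r a b) witness ≡ witness
          fixes-witness = trans (cong (CAut.to (symmetry r a b)) (sym (fixes witness (there (here refl))))) (undo witness)
          trivial : ∀ {r a b} → (∀ x → CAut.to (symmetry r a b) (CAut.to ψ x) ≡ x)
                  → r ≡ false × a ≡ false × b ≡ false → ∀ x → CAut.to ψ x ≡ x
          trivial undo (refl , refl , refl) = undo

  detNumber : DetNumberᶜ N 2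
  detNumber = (𝟎 ∷ witness ∷ [] , ((λ ()) ∷ []) ∷ [] ∷ [] , refl , 𝟎-witness-determining) , lower
    where
      front-moves-e₀ : front (e {N} 0) ≢ e 0
      front-moves-e₀ ()
      lower : ∀ S → Unique S → IsDeterminingᶜ N S → 2 ≤ length S
      lower [] _ det = ⊥-elim (front-moves-e₀ (det frontSwap (λ _ ()) (e 0)))
      lower (a ∷ []) _ det = ⊥-elim (¬determining frontSwap (front-fixes 𝟎 refl) front-moves-e₀ a [] (λ _ ()) det)
      lower (_ ∷ _ ∷ _) _ _ = s≤s (s≤s z≤n)

-- n ≤ 5, by computation

_≟ᵛ_ : ∀ {n} (x y : Vertex n) → Dec (x ≡ y)
_≟ᵛ_ = ≡-dec Bool._≟_

_∈?_ : ∀ {n} (x : Vertex n) (xs : List (Vertex n)) → Dec (x ∈ xs)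
x ∈? xs = Any.any? (x ≟ᵛ_) xs

unique? : ∀ {n} (xs : List (Vertex n)) → Dec (Unique xs)
unique? = AllPairs.allPairs? (λ x y → ¬? (x ≟ᵛ y))

IsZero? : ∀ {n} (x : Vertex n) → Dec (IsZero x)
IsZero? [] = yes z[]
IsZero? (true ∷ x) = no λ ()
IsZero? (false ∷ x) = map′ z∷ (λ { (z∷ z) → z }) (IsZero? x)

Gen? : ∀ {n} (x : Vertex n) → Dec (Gen x)
Gen? [] = no λ ()
Gen? (false ∷ x) = map′ shift (λ { (shift d) → d }) (Gen? x)
Gen? (true ∷ []) = yes (unit₀ z[])
Gen? (true ∷ false ∷ x) = map′ (λ z → unit₀ (z∷ z)) (λ { (unit₀ (z∷ z)) → z }) (IsZero? x)
Gen? (true ∷ true ∷ x) = map′ pair₀ (λ { (pair₀ z) → z }) (IsZero? x)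

adjᵇ : ∀ {n} → Vertex n → Vertex n → Bool
adjᵇ x y = ⌊ Gen? (x ⊕ y) ⌋

adjᵇ-invariant : ∀ {n} (ψ : CAut n) a b → adjᵇ (CAut.to ψ a) (CAut.to ψ b) ≡ adjᵇ a b
adjᵇ-invariant ψ a b = begin
  ⌊ Gen? (CAut.to ψ a ⊕ CAut.to ψ b) ⌋   ≡⟨ isYes≗does (Gen? _) ⟩
  does (Gen? (CAut.to ψ a ⊕ CAut.to ψ b)) ≡⟨ does-⇔ (mk⇔ (CAut.adj⇐ ψ a b) (CAut.adj⇒ ψ a b)) (Gen? _) (Gen? _) ⟩
  does (Gen? (a ⊕ b))                     ≡˘⟨ isYes≗does (Gen? _) ⟩
  ⌊ Gen? (a ⊕ b) ⌋                        ∎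

allVertices : ∀ n → List (Vertex n)
allVertices zero = [] ∷ []
allVertices (suc n) = map (false ∷_) (allVertices n) ++ map (true ∷_) (allVertices n)

∈-allVertices : ∀ {n} (x : Vertex n) → x ∈ allVertices n
∈-allVertices [] = here refl
∈-allVertices {suc n} (false ∷ x) = ∈-++⁺ˡ (∈-map⁺ (false ∷_) (∈-allVertices x))
∈-allVertices {suc n} (true ∷ x) = ∈-++⁺ʳ (map (false ∷_) (allVertices n)) (∈-map⁺ (true ∷_) (∈-allVertices x))

all-sound : ∀ {A : Set} (p : A → Bool) {xs x} → T (all p xs) → x ∈ xs → T (p x)
all-sound p {xs} h = All.lookup (All.all⁺ p xs h)

any-sound : ∀ {A : Set} (p : A → Bool) xs → T (any p xs) → Σ A λ x → x ∈ xs × T (p x)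
any-sound p xs h = find (Any.any⁻ p xs h)

distinguishes : ∀ {n} → List (Vertex n) → Vertex n → Vertex n → Bool
distinguishes F w y = any (λ f → adjᵇ w f xor adjᵇ y f) F

accountedFor : ∀ {n} → List (Vertex n) → Vertex n → Vertex n → Bool
accountedFor F w y = ⌊ y ∈? (w ∷ F) ⌋ ∨ distinguishes F w y

determinedBy : ∀ {n} → List (Vertex n) → Vertex n → Bool
determinedBy {n} F w = all (accountedFor F w) (allVertices n)

closure : ∀ {n} → ℕ → List (Vertex n) → List (Vertex n)
closure zero F = F
closure {n} (suc k) F = closure k (filterᵇ (determinedBy F) (allVertices n) ++ F)

module Refinement {n} (ψ : CAut n) where
  open CAut ψ

  determinedBy-fixed : ∀ {F w} → (∀ f → f ∈ F → to f ≡ f) → T (determinedBy F w) → to w ≡ w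
  determinedBy-fixed {F} {w} fixes det with Equivalence.to T-∨ (all-sound (accountedFor F w) det (∈-allVertices (to w)))
  ... | inj₁ member with toWitness {a? = to w ∈? (w ∷ F)} member
  ...   | here eq = eq
  ...   | there image∈F = to-injective (fixes _ image∈F)
  determinedBy-fixed {F} {w} fixes det | inj₂ dist with any-sound (λ f → adjᵇ w f xor adjᵇ (to w) f) F dist
  ... | f , f∈F , differ = ⊥-elim (subst T same-pattern differ)
    where
      same-pattern : adjᵇ w f xor adjᵇ (to w) f ≡ false
      same-pattern = begin
        adjᵇ w f xor adjᵇ (to w) f        ≡˘⟨ cong (λ y → adjᵇ w f xor adjᵇ (to w) y) (fixes f f∈F) ⟩
        adjᵇ w f xor adjᵇ (to w) (to f)   ≡⟨ cong (adjᵇ w f xor_) (adjᵇ-invariant ψ w f) ⟩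
        adjᵇ w f xor adjᵇ w f             ≡⟨ xor-same (adjᵇ w f) ⟩
        false                             ∎

  closure-fixed : ∀ k {F} → (∀ f → f ∈ F → to f ≡ f) → ∀ v → v ∈ closure k F → to v ≡ v
  closure-fixed zero fixes = fixes
  closure-fixed (suc k) {F} fixes = closure-fixed k fixes′
    where
      fixes′ : ∀ v → v ∈ filterᵇ (determinedBy F) (allVertices n) ++ F → to v ≡ v
      fixes′ v v∈ with ∈-++⁻ (filterᵇ (determinedBy F) (allVertices n)) v∈
      ... | inj₁ v∈new = determinedBy-fixed fixes (proj₂ (∈-filter⁻ (T? ∘ determinedBy F) {xs = allVertices n} v∈new))
      ... | inj₂ v∈F = fixes v v∈F

determining-by-closure : ∀ {n} k S → T (all (λ v → ⌊ v ∈? closure k S ⌋) (allVertices n)) → IsDeterminingᶜ n S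
determining-by-closure k S covered ψ fixes v = Refinement.closure-fixed ψ k fixes v (toWitness {a? = v ∈? closure k S} (all-sound (λ u → ⌊ u ∈? closure k S ⌋) covered (∈-allVertices v)))

_fixesᵇ_ : ∀ {n} → CAut n → Vertex n → Bool
g fixesᵇ x = ⌊ CAut.to g x ≟ᵛ x ⌋

movesSomething : ∀ {n} → CAut n → Bool
movesSomething {n} g = any (λ x → not (g fixesᵇ x)) (allVertices n)

base : ∀ {n} → List (Vertex n) → Vertex n
base [] = 𝟎
base (a ∷ _) = a

covers : ∀ {n} → List (CAut n) → List (Vertex n) → Bool
covers gs S = any (λ g → all (λ s → g fixesᵇ (base S ⊕ s)) S) gs

-- Conjugating by the translation by base S, it suffices that some g in gs fixes every base S ⊕ s.
covers-sound : ∀ {n} gs (S : List (Vertex n)) → T (all (λ g → g fixesᵇ 𝟎 ∧ movesSomething g) gs)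
             → T (covers gs S) → ¬ IsDeterminingᶜ n S
covers-sound gs S nontrivial cov det with any-sound (λ g → all (λ s → g fixesᵇ (base S ⊕ s)) S) gs cov
... | g , g∈gs , fixes-S with Equivalence.to T-∧ (all-sound (λ g → g fixesᵇ 𝟎 ∧ movesSomething g) nontrivial g∈gs)
...   | fixes-𝟎 , moves with any-sound (λ x → not (g fixesᵇ x)) (allVertices _) moves
...     | x , _ , x-moved = ¬covered S det fixes-S
  where
    ¬covered : ∀ S → IsDeterminingᶜ _ S → T (all (λ s → g fixesᵇ (base S ⊕ s)) S) → ⊥
    ¬covered [] det _ = toWitnessFalse {a? = CAut.to g x ≟ᵛ x} x-moved (det g (λ _ ()) x)
    ¬covered (a ∷ S) det fixes-S =
      ¬determining g (toWitness {a? = CAut.to g 𝟎 ≟ᵛ 𝟎} fixes-𝟎) (toWitnessFalse {a? = CAut.to g x ≟ᵛ x} x-moved) a S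
        (λ s s∈S → toWitness {a? = CAut.to g (a ⊕ s) ≟ᵛ (a ⊕ s)} (all-sound (λ s → g fixesᵇ (a ⊕ s)) fixes-S (there s∈S))) det

everyList : ∀ {n} → ℕ → (List (Vertex n) → Bool) → Bool
everyList zero P = P []
everyList {n} (suc m) P = all (λ x → everyList m (λ S → P (x ∷ S))) (allVertices n)

everyList-sound : ∀ {n} m (P : List (Vertex n) → Bool) → T (everyList m P) → ∀ S → length S ≡ m → T (P S)
everyList-sound zero P h [] refl = h
everyList-sound (suc m) P h (x ∷ S) refl = everyList-sound m (λ T → P (x ∷ T)) (all-sound (λ y → everyList m (λ S → P (y ∷ S))) h (∈-allVertices x)) S refl

lower-bound : ∀ {n} k (gs : List (CAut n)) → T (all (λ g → g fixesᵇ 𝟎 ∧ movesSomething g) gs)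
            → T (all (λ m → everyList m (covers gs)) (upTo k))
            → ∀ S → Unique S → IsDeterminingᶜ n S → k ≤ length S
lower-bound k gs nontrivial cov S _ det with k ≤? length S
... | yes k≤ = k≤
... | no k≰ = ⊥-elim (covers-sound gs S nontrivial (everyList-sound _ _ (all-sound (λ m → everyList m (covers gs)) cov (∈-upTo⁺ (≰⇒> k≰))) S refl) det)

nontrivialSymmetries : ∀ {n} → List (CAut n)
nontrivialSymmetries =
  symmetry false false true ∷ symmetry false true false ∷ symmetry false true true ∷ symmetry true false false ∷
  symmetry true false true ∷ symmetry true true false ∷ symmetry true true true ∷ []

isInvolutiveAutᵇ : ∀ {n} → (Vertex n → Vertex n) → Bool
isInvolutiveAutᵇ {n} f =
  all (λ x → ⌊ f (f x) ≟ᵛ x ⌋ ∧ all (λ y → ⌊ adjᵇ (f x) (f y) Bool.≟ adjᵇ x y ⌋) (allVertices n)) (allVertices n)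

checked-involution : ∀ {n} (f : Vertex n → Vertex n) → T (isInvolutiveAutᵇ f) → CAut n
checked-involution f ok = record
  { to = f ; from = f ; to-from = involutive ; from-to = involutive
  ; adj⇒ = λ a b d → toWitness {a? = Gen? (f a ⊕ f b)} (subst T (sym (adj-same a b)) (fromWitness {a? = Gen? (a ⊕ b)} d))
  ; adj⇐ = λ a b d → toWitness {a? = Gen? (a ⊕ b)} (subst T (adj-same a b) (fromWitness {a? = Gen? (f a ⊕ f b)} d)) }
  where
    at : ∀ x → T (⌊ f (f x) ≟ᵛ x ⌋ ∧ all (λ y → ⌊ adjᵇ (f x) (f y) Bool.≟ adjᵇ x y ⌋) (allVertices _))
    at x = all-sound (λ y → ⌊ f (f y) ≟ᵛ y ⌋ ∧ all (λ z → ⌊ adjᵇ (f y) (f z) Bool.≟ adjᵇ y z ⌋) (allVertices _)) ok (∈-allVertices x)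
    involutive : ∀ x → f (f x) ≡ x
    involutive x = toWitness {a? = f (f x) ≟ᵛ x} (proj₁ (Equivalence.to T-∧ (at x)))
    adj-same : ∀ a b → adjᵇ (f a) (f b) ≡ adjᵇ a b
    adj-same a b = toWitness {a? = adjᵇ (f a) (f b) Bool.≟ adjᵇ a b} (all-sound (λ y → ⌊ adjᵇ (f a) (f y) Bool.≟ adjᵇ a y ⌋) (proj₂ (Equivalence.to T-∧ (at a))) (∈-allVertices b))

swap : ∀ {n} → Vertex n → Vertex n → Vertex n → Vertex n
swap u w x with x ≟ᵛ u | x ≟ᵛ w
... | yes _ | _ = w
... | no _ | yes _ = u
... | no _ | no _ = x

-- In the Cayley graph for n = 3, x and x ⊕ e₁ have the same closed neighbourhood.
twinSwaps : List (CAut 3)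
twinSwaps =
  checked-involution (swap (true ∷ false ∷ false ∷ []) (true ∷ true ∷ false ∷ [])) _ ∷
  checked-involution (swap (false ∷ false ∷ true ∷ []) (false ∷ true ∷ true ∷ [])) _ ∷
  checked-involution (swap (true ∷ false ∷ true ∷ []) (true ∷ true ∷ true ∷ [])) _ ∷ []

computed-detNumber : ∀ {n} k (S : List (Vertex n)) (gs : List (CAut n)) → length S ≡ k
      → T ⌊ unique? S ⌋ → T (all (λ v → ⌊ v ∈? closure 3 S ⌋) (allVertices n))
      → T (all (λ g → g fixesᵇ 𝟎 ∧ movesSomething g) gs) → T (all (λ m → everyList m (covers gs)) (upTo k))
      → DetNumberᶜ n k
computed-detNumber k S gs len uniq closed nontrivial cov =
  (S , toWitness {a? = unique? S} uniq , len , determining-by-closure 3 S closed) , lower-bound k gs nontrivial cov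

detNumber-1 : DetNumberᶜ 1 1
detNumber-1 = ((false ∷ []) ∷ [] , [] ∷ [] , refl , determining-by-closure 1 _ _) , lower
  where
    lower : ∀ S → Unique S → IsDeterminingᶜ 1 S → 1 ≤ length S
    lower [] _ det with det (translation (true ∷ [])) (λ _ ()) (false ∷ [])
    ... | ()
    lower (_ ∷ _) _ _ = s≤s z≤n

detNumber-2 : DetNumberᶜ 2 3
detNumber-2 = computed-detNumber 3
  ((false ∷ false ∷ []) ∷ (false ∷ true ∷ []) ∷ (true ∷ false ∷ []) ∷ [])
  nontrivialSymmetries refl _ _ _ _

detNumber-3 : DetNumberᶜ 3 4
detNumber-3 = computed-detNumber 4
  ((false ∷ false ∷ false ∷ []) ∷ (false ∷ false ∷ true ∷ []) ∷ (true ∷ false ∷ false ∷ []) ∷ (true ∷ false ∷ true ∷ []) ∷ [])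
  (nontrivialSymmetries ++ twinSwaps) refl _ _ _ _

detNumber-4 : DetNumberᶜ 4 3
detNumber-4 = computed-detNumber 3
  ((false ∷ false ∷ false ∷ false ∷ []) ∷ (false ∷ false ∷ false ∷ true ∷ []) ∷ (true ∷ false ∷ false ∷ false ∷ []) ∷ [])
  nontrivialSymmetries refl _ _ _ _

detNumber-5 : DetNumberᶜ 5 3
detNumber-5 = computed-detNumber 3
  ((false ∷ false ∷ false ∷ false ∷ false ∷ []) ∷ (false ∷ false ∷ false ∷ false ∷ true ∷ []) ∷
   (true ∷ false ∷ false ∷ true ∷ false ∷ []) ∷ [])
  nontrivialSymmetries refl _ _ _ _

theorem7p3 : DetNumber 1 1 × DetNumber 2 3 × DetNumber 3 4
               × DetNumber 4 3 × DetNumber 5 3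
               × (∀ (n : ℕ) → 6 ≤ n → DetNumber n 2)
theorem7p3 =
  DetNumberᶜ⇒DetNumber detNumber-1 , DetNumberᶜ⇒DetNumber detNumber-2 , DetNumberᶜ⇒DetNumber detNumber-3 ,
  DetNumberᶜ⇒DetNumber detNumber-4 , DetNumberᶜ⇒DetNumber detNumber-5 , large
  where
    large : ∀ n → 6 ≤ n → DetNumber n 2
    large _ (s≤s (s≤s (s≤s (s≤s (s≤s (s≤s {n = q} _)))))) = DetNumberᶜ⇒DetNumber (AtLeastSix.detNumber q)
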